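{- Let $\mathbb{F}$ be a finite field with $q$ elements and $n\ge2$ an integer. Let $N=\frac{q^n-1}{q-1}$ and let $v_1,\dots,v_N$ be an enumeration of the $1$-dimensional subspaces of $\mathbb{F}^n$. Let $K$ be a field of characteristic zero and $F=\sum X_{i_1}\cdots X_{i_n}\in K[X_1,\dots,X_N]$, summed over all $1\le i_1<\cdots<i_n\le N$ such that $v_{i_1},\dots,v_{i_n}$ form a basis of $\mathbb{F}^n$, with Hessian matrix $H(F)=\left(\frac{\partial^2F}{\partial X_i\partial X_j}\right)$. Set $c=\frac{q^{(n^2-n-2)/2}}{(n-2)!}\prod_{k=1}^{n-2}\frac{q^k-1}{q-1}$. Then $H(F)\big|_{X_1=\cdots=X_N=1}$ is the $N\times N$ matrix with all diagonal entries $0$ and all off-diagonal entries $c$, and $\left|\det H(F)\big|_{X_1=\cdots=X_N=1}\right|=(N-1)\,c^{N}.$ -}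

module Defs where

open import Level using (Level; _⊔_) renaming (suc to lsuc)
open import Data.Nat using (ℕ; zero; suc; _∸_; _!; NonZero)
import Data.Nat as ℕ
open import Data.Nat.DivMod using (_/_)
open import Data.Nat.Properties using (_!≢0)
open import Data.Fin using (Fin; zero; suc; punchIn)
import Data.Fin as Fin
open import Data.Fin.Properties using (all?; any?)
open import Data.Vec using (Vec; []; _∷_)
import Data.Vec as Vec
open import Data.List using (List; []; _∷_; _++_; filter; foldr)
import Data.List as List
open import Data.Product using (Σ; ∃; _×_; _,_; proj₁; proj₂)
open import Data.Bool using (if_then_else_)
open import Data.Empty using (⊥-elim)
open import Function using (_∘_)
open import Relation.Nullary using (¬_; Dec; yes; no)
open import Relation.Nullary.Decidable using (⌊_⌋; _×-dec_; _→-dec_; map′)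
open import Relation.Binary.PropositionalEquality using (_≡_)
open import Algebra.Bundles using (CommutativeRing)

record Field (a ℓ : Level) : Set (lsuc (a ⊔ ℓ)) where
  field
    commutativeRing : CommutativeRing a ℓ
  open CommutativeRing commutativeRing public hiding (zero)
  field
    1≉0        : ¬ (1# ≈ 0#)
    inv        : (x : Carrier) → ¬ (x ≈ 0#) → Carrier
    inv-cancel : ∀ x (p : ¬ (x ≈ 0#)) → (x * inv x p) ≈ 1#

  fromℕ : ℕ → Carrier
  fromℕ zero    = 0#
  fromℕ (suc m) = 1# + fromℕ m

  pow : Carrier → ℕ → Carrier
  pow x zero    = 1#
  pow x (suc m) = x * pow x m

  sumF : ∀ {m} → (Fin m → Carrier) → Carrier
  sumF {zero}  f = 0#
  sumF {suc m} f = f zero + sumF (f ∘ suc)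

record FiniteField (a ℓ : Level) (q : ℕ) : Set (lsuc (a ⊔ ℓ)) where
  field
    field′ : Field a ℓ
  open Field field′ public
  field
    enum       : Fin q → Carrier
    index      : Carrier → Fin q
    enum-index : ∀ x → enum (index x) ≈ x
    enum-inj   : ∀ i j → enum i ≈ enum j → i ≡ j

CharZero : ∀ {a ℓ} → Field a ℓ → Set ℓ
CharZero K = ∀ m → ¬ (fromℕ (suc m) ≈ 0#)
  where open Field K

module LinAlg {a ℓ q} (𝔽 : FiniteField a ℓ q) where
  open FiniteField 𝔽

  Vector : ℕ → Set a
  Vector n = Fin n → Carrier

  _≋_ : ∀ {n} → Vector n → Vector n → Set ℓ
  u ≋ w = ∀ k → u k ≈ w k

  0V : ∀ {n} → Vector n
  0V k = 0#

  _·_ : ∀ {n} → Carrier → Vector n → Vector n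
  (λ′ · w) k = λ′ * w k

  lincomb : ∀ {n m} → (Fin m → Carrier) → (Fin m → Vector n) → Vector n
  lincomb a w k = sumF (λ j → a j * w j k)

  LinIndep : ∀ {n m} → (Fin m → Vector n) → Set (a ⊔ ℓ)
  LinIndep w = ∀ c → lincomb c w ≋ 0V → ∀ j → c j ≈ 0#

  Spans : ∀ {n m} → (Fin m → Vector n) → Set (a ⊔ ℓ)
  Spans {n} w = ∀ (u : Vector n) → ∃ λ c → lincomb c w ≋ u

  IsBasis : ∀ {n m} → (Fin m → Vector n) → Set (a ⊔ ℓ)
  IsBasis w = LinIndep w × Spans w

  -- v : Fin N → 𝔽^n enumerates the 1-dimensional subspaces of 𝔽^n:
  -- v_i spans the line L_i = 𝔽·v_i, every line is some L_i, and the
  -- L_i are pairwise distinct.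
  record IsLineEnumeration (n N : ℕ) (v : Fin N → Vector n) : Set (a ⊔ ℓ) where
    field
      nonzero  : ∀ i → ¬ (v i ≋ 0V)
      covers   : ∀ (w : Vector n) → ¬ (w ≋ 0V) → ∃ λ i → ∃ λ λ′ → w ≋ (λ′ · v i)
      distinct : ∀ i j λ′ → v i ≋ (λ′ · v j) → i ≡ j

  -- decidability (needed to form the sum defining F)

  _≟_ : ∀ x y → Dec (x ≈ y)
  x ≟ y with index x Fin.≟ index y
  ... | yes p = yes (trans (sym (enum-index x))
                      (trans (reflexive′ p) (enum-index y)))
    where reflexive′ : index x ≡ index y → enum (index x) ≈ enum (index y)
          reflexive′ e rewrite e = refl′
            where refl′ = Field.refl field′
  ... | no ¬p = no λ e → ¬p (enum-inj _ _
                   (trans (enum-index x) (trans e (sym (enum-index y)))))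

  consF : ∀ {m} → Carrier → (Fin m → Carrier) → Fin (suc m) → Carrier
  consF x g zero    = x
  consF x g (suc k) = g k

  Resp : ∀ {m p} → ((Fin m → Carrier) → Set p) → Set _
  Resp {m} P = ∀ {f g : Fin m → Carrier} → (∀ k → f k ≈ g k) → P f → P g

  ∀fun? : ∀ {p} m (P : (Fin m → Carrier) → Set p) → Resp P →
          (∀ f → Dec (P f)) → Dec (∀ f → P f)
  ∀fun? zero P resp P? with P? (λ ())
  ... | yes p = yes λ f → resp (λ ()) p
  ... | no ¬p = no λ h → ¬p (h _)
  ∀fun? (suc m) P resp P? =
    map′ to from (all? λ i → ∀fun? m (λ g → P (consF (enum i) g))
                    (λ e → resp (λ { zero → Field.refl field′ ; (suc k) → e k }))
                    (λ g → P? (consF (enum i) g)))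
    where
      to : (∀ i g → P (consF (enum i) g)) → ∀ f → P f
      to h f = resp (λ { zero → enum-index (f zero) ; (suc k) → Field.refl field′ })
                    (h (index (f zero)) (f ∘ suc))
      from : (∀ f → P f) → ∀ i g → P (consF (enum i) g)
      from h i g = h _

  ∃fun? : ∀ {p} m (P : (Fin m → Carrier) → Set p) → Resp P →
          (∀ f → Dec (P f)) → Dec (∃ λ f → P f)
  ∃fun? zero P resp P? with P? (λ ())
  ... | yes p = yes (_ , p)
  ... | no ¬p = no λ { (f , pf) → ¬p (resp (λ ()) pf) }
  ∃fun? (suc m) P resp P? =
    map′ to from (any? λ i → ∃fun? m (λ g → P (consF (enum i) g))
                    (λ e → resp (λ { zero → Field.refl field′ ; (suc k) → e k }))
                    (λ g → P? (consF (enum i) g)))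
    where
      to : (∃ λ i → ∃ λ g → P (consF (enum i) g)) → ∃ λ f → P f
      to (i , g , p) = _ , p
      from : (∃ λ f → P f) → ∃ λ i → ∃ λ g → P (consF (enum i) g)
      from (f , pf) = index (f zero) , f ∘ suc ,
        resp (λ { zero → sym (enum-index (f zero)) ; (suc k) → Field.refl field′ }) pf

  sumF-cong : ∀ {m} {f g : Fin m → Carrier} → (∀ k → f k ≈ g k) → sumF f ≈ sumF g
  sumF-cong {zero}  e = Field.refl field′
  sumF-cong {suc m} e = +-cong (e zero) (sumF-cong (e ∘ suc))

  lincomb-cong : ∀ {n m} {c d : Fin m → Carrier} (w : Fin m → Vector n) →
                 (∀ j → c j ≈ d j) → lincomb c w ≋ lincomb d w
  lincomb-cong w e k = sumF-cong (λ j → *-cong (e j) (Field.refl field′))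

  ≋? : ∀ {n} (u w : Vector n) → Dec (u ≋ w)
  ≋? u w = all? (λ k → u k ≟ w k)

  isBasis? : ∀ {n m} (w : Fin m → Vector n) → Dec (IsBasis w)
  isBasis? {n} {m} w = indep? ×-dec spans?
    where
      indep? : Dec (LinIndep w)
      indep? = ∀fun? m _
        (λ {c} {d} e h ld j → trans (sym (e j))
           (h (λ k → trans (lincomb-cong w e k) (ld k)) j))
        (λ c → ≋? (lincomb c w) 0V →-dec all? (λ j → c j ≟ 0#))
      spans? : Dec (Spans w)
      spans? = ∀fun? n _
        (λ e h → let (c , p) = h in c , λ k → trans (p k) (e k))
        (λ u → ∃fun? m _
          (λ e p k → trans (sym (lincomb-cong w e k)) (p k))
          (λ c → ≋? (lincomb c w) u))

module PolyOps {a ℓ} (K : Field a ℓ) where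
  open Field K

  Poly : ℕ → Set a
  Poly N = List (Carrier × (Fin N → ℕ))

  ∂ : ∀ {N} → Fin N → Poly N → Poly N
  ∂ i = List.map λ { (c , α) →
          (c * fromℕ (α i)) , (λ j → if ⌊ j Fin.≟ i ⌋ then α i ∸ 1 else α j) }

  eval1 : ∀ {N} → Poly N → Carrier
  eval1 = foldr (λ t s → proj₁ t + s) 0#

  hessian1 : ∀ {N} → Poly N → Fin N → Fin N → Carrier
  hessian1 P i j = eval1 (∂ i (∂ j P))

  altSum : ∀ {m} → (Fin m → Carrier) → Carrier
  altSum {zero}  f = 0#
  altSum {suc m} f = f zero + (- altSum (f ∘ suc))

  det : ∀ m → (Fin m → Fin m → Carrier) → Carrier
  det zero    M = 1#
  det (suc m) M = altSum λ j → M zero j * det m (λ r c → M (suc r) (punchIn j c))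

increasing : (k m : ℕ) → List (Vec (Fin m) k)
increasing zero    m       = [] ∷ []
increasing (suc k) zero    = []
increasing (suc k) (suc m) =
  List.map (λ t → zero ∷ Vec.map suc t) (increasing k m)
  ++ List.map (Vec.map suc) (increasing (suc k) m)

monomialExp : ∀ {k N} → Vec (Fin N) k → Fin N → ℕ
monomialExp []      j = 0
monomialExp (x ∷ t) j = (if ⌊ x Fin.≟ j ⌋ then 1 else 0) ℕ.+ monomialExp t j

-- (q^k - 1)/(q - 1)  (exact division; q ≥ 2 for any field)
qNum : ℕ → ℕ → ℕ
qNum (suc (suc r)) k = (suc (suc r) ℕ.^ k ∸ 1) / suc r
qNum _             k = 0

numLines : ℕ → ℕ → ℕ
numLines q n = qNum q n

prodFrom1 : ℕ → (ℕ → ℕ) → ℕ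
prodFrom1 zero    f = 1
prodFrom1 (suc m) f = prodFrom1 m f ℕ.* f (suc m)

basisPoly : ∀ {a ℓ a′ ℓ′ q} (𝔽 : FiniteField a ℓ q) (n N : ℕ)
            (v : Fin N → LinAlg.Vector 𝔽 n) (K : Field a′ ℓ′) → PolyOps.Poly K N
basisPoly 𝔽 n N v K =
  List.map (λ t → Field.1# K , monomialExp t)
    (filter (λ t → LinAlg.isBasis? 𝔽 (λ k → v (Vec.lookup t k))) (increasing n N))

ℕ≉0 : ∀ {a ℓ} (K : Field a ℓ) → CharZero K → ∀ m → .{{NonZero m}} →
      ¬ (Field._≈_ K (Field.fromℕ K m) (Field.0# K))
ℕ≉0 K cz (suc m) = cz m

constC : ∀ {a ℓ} (K : Field a ℓ) → CharZero K → (q n : ℕ) → Field.Carrier K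
constC K cz q n =
  fromℕ (q ℕ.^ ((n ℕ.* n ∸ n ∸ 2) / 2) ℕ.* prodFrom1 (n ∸ 2) (qNum q))
  * inv (fromℕ ((n ∸ 2) !)) (ℕ≉0 K cz ((n ∸ 2) !) {{fact≢0}})
  where
    open Field K
    fact≢0 = (n ∸ 2) !≢0

-- Every monomial of F is squarefree, so ∂ᵢ∂ⱼF vanishes at 1 when i = j, and for i ≠ j it counts the
-- n-subsets of lines containing vᵢ and vⱼ that give a basis. Such a basis is built from {vᵢ, vⱼ} by adding
-- lines one at a time, and an independent set spanning a d-dimensional subspace can be extended by exactly
-- (qⁿ - q^d)/(q - 1) lines; accounting for the (n - 2)! orders of the added lines, the count is
-- ∏_{d=2}^{n-1} (qⁿ - q^d)/(q - 1) / (n - 2)! = c. So H(F) at 1 is c(J - I), and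
-- det c(J - I) = (-1)^(N-1) (N - 1) c^N, computed by row operations from the Laplace expansion.

module Submission where

open import Defs
open import Data.Nat using (ℕ; _≤_; _∸_)
open import Data.Fin using (Fin)
open import Data.Product using (_×_)
open import Data.Sum using (_⊎_)
open import Relation.Nullary using (¬_)
open import Relation.Binary.PropositionalEquality using (_≡_)

module Counting where

  open import Data.Nat using (ℕ; zero; suc; _+_; _*_; _∸_; _^_; _≤_; z≤n; s≤s)
  open import Data.Nat.Properties hiding (suc-injective)
  open import Data.Fin using (Fin; zero; suc; inject₁; _↑ˡ_; _↑ʳ_; combine; finToFun)
  open import Data.Fin.Properties using (remQuot-combine; suc-injective)
  import Data.Fin.Properties as Fin
  open import Data.Bool using (Bool; true; false; not; _∧_)
  open import Data.Bool.Properties using (∧-zeroʳ; ∧-identityʳ)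
  open import Data.Product using (_×_; _,_; proj₁; proj₂; ∃)
  open import Data.Empty using (⊥-elim)
  open import Function using (_∘_)
  open import Relation.Binary.PropositionalEquality
  open import Relation.Nullary using (Dec; yes; no; ¬_)
  open import Relation.Nullary.Decidable using (⌊_⌋)
  open import Algebra.Properties.Semiring.Sum +-*-semiring public
    using (sum; sum-cong-≗; ∑-distrib-+; ∑-comm; *-distribˡ-sum)

  ⌊⌋-yes : ∀ {p} {A : Set p} (a? : Dec A) → A → ⌊ a? ⌋ ≡ true
  ⌊⌋-yes (yes _)  _ = refl
  ⌊⌋-yes (no ¬a) a = ⊥-elim (¬a a)

  ⌊⌋-no : ∀ {p} {A : Set p} (a? : Dec A) → ¬ A → ⌊ a? ⌋ ≡ false
  ⌊⌋-no (yes a) ¬a = ⊥-elim (¬a a)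
  ⌊⌋-no (no _)  _  = refl

  ⌊⌋-yes⁻¹ : ∀ {p} {A : Set p} (a? : Dec A) → ⌊ a? ⌋ ≡ true → A
  ⌊⌋-yes⁻¹ (yes a) _ = a

  infix 4 _==_

  _==_ : ∀ {m} → Fin m → Fin m → Bool
  zero  == zero  = true
  zero  == suc _ = false
  suc _ == zero  = false
  suc x == suc y = x == y

  ==-refl : ∀ {m} (x : Fin m) → (x == x) ≡ true
  ==-refl zero    = refl
  ==-refl (suc x) = ==-refl x

  ==⇒≡ : ∀ {m} (x y : Fin m) → (x == y) ≡ true → x ≡ y
  ==⇒≡ zero    zero    e = refl
  ==⇒≡ (suc x) (suc y) e = cong suc (==⇒≡ x y e)

  ==-false⇒≢ : ∀ {m} (x y : Fin m) → (x == y) ≡ false → x ≢ y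
  ==-false⇒≢ (suc x) (suc y) e refl = ==-false⇒≢ x y e refl

  ≢⇒==-false : ∀ {m} (x y : Fin m) → x ≢ y → (x == y) ≡ false
  ≢⇒==-false x y x≢y with x == y in e
  ... | true  = ⊥-elim (x≢y (==⇒≡ x y e))
  ... | false = refl

  suc==inject₁ : ∀ {m} (r : Fin m) → (suc r == inject₁ r) ≡ false
  suc==inject₁ zero    = refl
  suc==inject₁ (suc r) = suc==inject₁ r

  𝟙 : Bool → ℕ
  𝟙 true  = 1
  𝟙 false = 0

  𝟙-∧ : ∀ x y → 𝟙 (x ∧ y) ≡ 𝟙 x * 𝟙 y
  𝟙-∧ true  y = sym (+-identityʳ (𝟙 y))
  𝟙-∧ false y = refl

  𝟙≤1 : ∀ b → 𝟙 b ≤ 1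
  𝟙≤1 true  = s≤s z≤n
  𝟙≤1 false = z≤n

  sum-zero : ∀ {a} (f : Fin a → ℕ) → (∀ i → f i ≡ 0) → sum f ≡ 0
  sum-zero {zero}  f f≡0 = refl
  sum-zero {suc a} f f≡0 rewrite f≡0 zero = sum-zero (f ∘ suc) (f≡0 ∘ suc)

  sum-const : ∀ {a} k → sum {a} (λ _ → k) ≡ a * k
  sum-const {zero}  k = refl
  sum-const {suc a} k = cong (k +_) (sum-const {a} k)

  *-distribʳ-sum : ∀ {a} (f : Fin a → ℕ) k → sum (λ i → f i * k) ≡ sum f * k
  *-distribʳ-sum f k = begin
    sum (λ i → f i * k) ≡⟨ sum-cong-≗ (λ i → *-comm (f i) k) ⟩
    sum (λ i → k * f i) ≡⟨ *-distribˡ-sum k f ⟨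
    k * sum f           ≡⟨ *-comm k (sum f) ⟩
    sum f * k           ∎
    where open ≡-Reasoning

  sum-single : ∀ {a} (f : Fin a → ℕ) (y : Fin a) → (∀ i → i ≢ y → f i ≡ 0) → sum f ≡ f y
  sum-single {suc a} f zero    f≡0 =
    trans (cong (f zero +_) (sum-zero (f ∘ suc) (λ i → f≡0 (suc i) λ ()))) (+-identityʳ _)
  sum-single {suc a} f (suc y) f≡0 rewrite f≡0 zero (λ ()) =
    sum-single (f ∘ suc) y (λ i i≢y → f≡0 (suc i) (i≢y ∘ suc-injective))

  sum-↑ : ∀ k l (f : Fin (k + l) → ℕ) → sum f ≡ sum (λ i → f (i ↑ˡ l)) + sum (λ j → f (k ↑ʳ j))
  sum-↑ zero    l f = refl
  sum-↑ (suc k) l f = trans (cong (f zero +_) (sum-↑ k l (f ∘ suc))) (sym (+-assoc (f zero) _ _))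

  sum-combine : ∀ m k (f : Fin (m * k) → ℕ) → sum f ≡ sum {m} (λ i → sum {k} (λ j → f (combine i j)))
  sum-combine zero    k f = refl
  sum-combine (suc m) k f =
    trans (sum-↑ k (m * k) f) (cong (sum (λ j → f (j ↑ˡ (m * k))) +_) (sum-combine m k (f ∘ (k ↑ʳ_))))

  finToFun-combine-zero : ∀ {q N} (i : Fin q) (y : Fin (q ^ N)) → finToFun {q} {suc N} (combine i y) zero ≡ i
  finToFun-combine-zero {q} {N} i y = cong proj₁ (remQuot-combine {q} {q ^ N} i y)

  finToFun-combine-suc : ∀ {q N} (i : Fin q) (y : Fin (q ^ N)) k →
    finToFun {q} {suc N} (combine i y) (suc k) ≡ finToFun y k
  finToFun-combine-suc {q} {N} i y k = cong (λ r → finToFun (proj₂ r) k) (remQuot-combine {q} {q ^ N} i y)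

  count : ∀ {a} → (Fin a → Bool) → ℕ
  count p = sum (𝟙 ∘ p)

  count-cong : ∀ {a} {p p′ : Fin a → Bool} → (∀ i → p i ≡ p′ i) → count p ≡ count p′
  count-cong p≡p′ = sum-cong-≗ (cong 𝟙 ∘ p≡p′)

  count≤ : ∀ {a} (p : Fin a → Bool) → count p ≤ a
  count≤ {zero}  p = z≤n
  count≤ {suc a} p = +-mono-≤ (𝟙≤1 (p zero)) (count≤ (p ∘ suc))

  count-complement : ∀ {a} (p : Fin a → Bool) → count p + count (not ∘ p) ≡ a
  count-complement {zero}  p = refl
  count-complement {suc a} p with p zero
  ... | true  = cong suc (count-complement (p ∘ suc))
  ... | false = trans (+-suc (count (p ∘ suc)) _) (cong suc (count-complement (p ∘ suc)))

  count≡0⇒false : ∀ {a} (p : Fin a → Bool) → count p ≡ 0 → ∀ x → p x ≡ false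
  count≡0⇒false p c≡0 zero with p zero
  ... | true  = ⊥-elim (1+n≢0 c≡0)
  ... | false = refl
  count≡0⇒false p c≡0 (suc x) with p zero
  ... | true  = ⊥-elim (1+n≢0 c≡0)
  ... | false = count≡0⇒false (p ∘ suc) c≡0 x

  count≡size⇒true : ∀ {a} (p : Fin a → Bool) → count p ≡ a → ∀ x → p x ≡ true
  count≡size⇒true {a} p full x with p x in px | count≡0⇒false (not ∘ p) none x
    where
    none : count (not ∘ p) ≡ 0
    none = +-cancelˡ-≡ (count p) _ 0 (trans (count-complement p) (trans (sym full) (sym (+-identityʳ (count p)))))
  ... | true  | _  = refl
  ... | false | ()

  count-== : ∀ {a} (y : Fin a) → count (_== y) ≡ 1
  count-== y = trans (sum-single _ y 𝟙[i==y]≡0) (cong 𝟙 (==-refl y))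
    where
    𝟙[i==y]≡0 : ∀ i → i ≢ y → 𝟙 (i == y) ≡ 0
    𝟙[i==y]≡0 i i≢y = cong 𝟙 (≢⇒==-false i y i≢y)

  count-≠ : ∀ {a} (y : Fin a) → count (not ∘ (_== y)) ≡ a ∸ 1
  count-≠ {a} y = begin
    count (not ∘ (_== y))                           ≡⟨ m+n∸m≡n 1 _ ⟨
    1 + count (not ∘ (_== y)) ∸ 1                   ≡⟨ cong (λ k → k + count (not ∘ (_== y)) ∸ 1) (count-== y) ⟨
    count (_== y) + count (not ∘ (_== y)) ∸ 1       ≡⟨ cong (_∸ 1) (count-complement (_== y)) ⟩
    a ∸ 1                                           ∎
    where open ≡-Reasoning

  without : ∀ {b} → (Fin b → Bool) → Fin b → Fin b → Bool
  without p y x = p x ∧ not (x == y)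

  suc-count-without : ∀ {b} (p : Fin b → Bool) (y : Fin b) → p y ≡ true → suc (count (without p y)) ≡ count p
  suc-count-without {suc b} p zero py = begin
    suc (𝟙 (p zero ∧ false) + count (λ x → p (suc x) ∧ true))
      ≡⟨ cong suc (cong₂ _+_ (cong 𝟙 (∧-zeroʳ (p zero))) (count-cong (λ x → ∧-identityʳ (p (suc x))))) ⟩
    suc (count (p ∘ suc))             ≡⟨ cong (λ b → 𝟙 b + count (p ∘ suc)) py ⟨
    𝟙 (p zero) + count (p ∘ suc)      ∎
    where open ≡-Reasoning
  suc-count-without {suc b} p (suc y) py with p zero
  ... | true  = cong suc (suc-count-without (p ∘ suc) y py)
  ... | false = suc-count-without (p ∘ suc) y py

  count≤suc-count-without : ∀ {b} (p : Fin b → Bool) (y : Fin b) → count p ≤ suc (count (without p y))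
  count≤suc-count-without p y with p y in py
  ... | true  = ≤-reflexive (sym (suc-count-without p y py))
  ... | false = ≤-trans (≤-reflexive (count-cong p≡without)) (n≤1+n _)
    where
    p≡without : ∀ x → p x ≡ without p y x
    p≡without x with x == y in x==y
    ... | true rewrite ==⇒≡ x y x==y | py = refl
    ... | false = sym (∧-identityʳ (p x))

  module _ {a b} (p : Fin a → Bool) (p′ : Fin b → Bool) (f : Fin a → Fin b) where

    MapsTo : Set
    MapsTo = ∀ x → p x ≡ true → p′ (f x) ≡ true

    InjectiveOn : Set
    InjectiveOn = ∀ x y → p x ≡ true → p y ≡ true → f x ≡ f y → x ≡ y

    SurjectiveOnto : Set
    SurjectiveOnto = ∀ y → p′ y ≡ true → ∃ λ x → p x ≡ true × f x ≡ y

  count-injection : ∀ {a b} (p : Fin a → Bool) (p′ : Fin b → Bool) (f : Fin a → Fin b) →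
    MapsTo p p′ f → InjectiveOn p p′ f → count p ≤ count p′
  count-injection {zero}  p p′ f maps inj = z≤n
  count-injection {suc a} p p′ f maps inj with p zero in p0
  ... | false = count-injection (p ∘ suc) p′ (f ∘ suc) (maps ∘ suc)
                  (λ x y px py e → suc-injective (inj (suc x) (suc y) px py e))
  ... | true  = ≤-trans (s≤s rest) (≤-reflexive (suc-count-without p′ (f zero) (maps zero p0)))
    where
    maps′ : MapsTo (p ∘ suc) (without p′ (f zero)) (f ∘ suc)
    maps′ x px rewrite maps (suc x) px
                     | ≢⇒==-false (f (suc x)) (f zero) (λ e → Fin.0≢1+n (sym (inj (suc x) zero px p0 e))) = refl
    rest : count (p ∘ suc) ≤ count (without p′ (f zero))
    rest = count-injection (p ∘ suc) (without p′ (f zero)) (f ∘ suc) maps′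
             (λ x y px py e → suc-injective (inj (suc x) (suc y) px py e))

  count-surjection : ∀ {a b} (p : Fin a → Bool) (p′ : Fin b → Bool) (f : Fin a → Fin b) →
    SurjectiveOnto p p′ f → count p′ ≤ count p
  count-surjection {zero}  p p′ f onto = ≤-reflexive (sum-zero _ (λ y → cong 𝟙 (p′≡false y)))
    where
    p′≡false : ∀ y → p′ y ≡ false
    p′≡false y with p′ y in p′y
    ... | true with () ← proj₁ (onto y p′y)
    ... | false = refl
  count-surjection {suc a} p p′ f onto with p zero in p0
  ... | false = count-surjection (p ∘ suc) p′ (f ∘ suc) onto′
    where
    onto′ : SurjectiveOnto (p ∘ suc) p′ (f ∘ suc)
    onto′ y p′y with onto y p′y
    ... | zero  , px , _ with () ← trans (sym px) p0
    ... | suc x , px , e = x , px , e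
  ... | true  = ≤-trans (count≤suc-count-without p′ (f zero)) (s≤s rest)
    where
    onto′ : SurjectiveOnto (p ∘ suc) (without p′ (f zero)) (f ∘ suc)
    onto′ y wy with p′ y in p′y | y == f zero in y==f0
    onto′ y () | true  | true
    onto′ y () | false | _
    ... | true | false with onto y p′y
    ...   | zero  , _  , e = ⊥-elim (==-false⇒≢ y (f zero) y==f0 (sym e))
    ...   | suc x , px , e = x , px , e
    rest : count (without p′ (f zero)) ≤ count (p ∘ suc)
    rest = count-surjection (p ∘ suc) (without p′ (f zero)) (f ∘ suc) onto′

  count-bijection : ∀ {a b} (p : Fin a → Bool) (p′ : Fin b → Bool) (f : Fin a → Fin b) →
    MapsTo p p′ f → InjectiveOn p p′ f → SurjectiveOnto p p′ f → count p ≡ count p′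
  count-bijection p p′ f maps inj onto =
    ≤-antisym (count-injection p p′ f maps inj) (count-surjection p p′ f onto)

module Subsets where

  open import Data.Nat using (ℕ; zero; suc; _+_; _*_; _^_; _≤_; _≡ᵇ_)
  open import Data.Nat.Properties hiding (suc-injective)
  open import Data.Fin using (Fin; zero; suc; combine; finToFun)
  open import Data.Bool using (Bool; true; false; not; _∧_; _∨_)
  open import Data.Bool.Properties using (∧-zeroʳ; ∧-identityʳ; ∧-assoc)
  open import Data.Bool using (T)
  open import Data.Empty using (⊥-elim)
  open import Data.Vec using (Vec; []; _∷_; lookup; replicate)
  open import Function using (_∘_)
  open import Relation.Binary.PropositionalEquality

  open Counting

  Subset : ℕ → Set
  Subset N = Vec Bool N

  size : ∀ {N} → Subset N → ℕ
  size []      = 0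
  size (b ∷ s) = 𝟙 b + size s

  ∅ : ∀ {N} → Subset N
  ∅ {N} = replicate N false

  insert : ∀ {N} → Fin N → Subset N → Subset N
  insert zero    (b ∷ s) = true ∷ s
  insert (suc i) (b ∷ s) = b ∷ insert i s

  _⊆ᵇ_ : ∀ {N} → Subset N → Subset N → Bool
  []      ⊆ᵇ []      = true
  (a ∷ A) ⊆ᵇ (b ∷ s) = (not a ∨ b) ∧ (A ⊆ᵇ s)

  pair : ∀ {N} → Fin N → Fin N → Subset N
  pair i j = insert i (insert j ∅)

  lookup-∅ : ∀ {N} (i : Fin N) → lookup (∅ {N}) i ≡ false
  lookup-∅ zero    = refl
  lookup-∅ (suc i) = lookup-∅ i

  lookup-insert : ∀ {N} (ℓ : Fin N) (s : Subset N) i → lookup (insert ℓ s) i ≡ ((i == ℓ) ∨ lookup s i)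
  lookup-insert zero    (b ∷ s) zero    = refl
  lookup-insert zero    (b ∷ s) (suc i) = refl
  lookup-insert (suc ℓ) (b ∷ s) zero    = refl
  lookup-insert (suc ℓ) (b ∷ s) (suc i) = lookup-insert ℓ s i

  size-∅ : ∀ {N} → size (∅ {N}) ≡ 0
  size-∅ {zero}  = refl
  size-∅ {suc N} = size-∅ {N}

  size-insert : ∀ {N} (ℓ : Fin N) (s : Subset N) → lookup s ℓ ≡ false → size (insert ℓ s) ≡ suc (size s)
  size-insert zero    (false ∷ s) _   = refl
  size-insert (suc ℓ) (b ∷ s)     ℓ∉s = trans (cong (𝟙 b +_) (size-insert ℓ s ℓ∉s)) (+-suc (𝟙 b) (size s))

  ∅⊆ᵇ : ∀ {N} (s : Subset N) → (∅ ⊆ᵇ s) ≡ true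
  ∅⊆ᵇ []      = refl
  ∅⊆ᵇ (b ∷ s) = ∅⊆ᵇ s

  insert⊆ᵇ : ∀ {N} (ℓ : Fin N) (A s : Subset N) → (insert ℓ A ⊆ᵇ s) ≡ (lookup s ℓ ∧ (A ⊆ᵇ s))
  insert⊆ᵇ zero    (a ∷ A) (b ∷ s) with a | b
  ... | true  | true  = refl
  ... | true  | false = refl
  ... | false | true  = refl
  ... | false | false = refl
  insert⊆ᵇ (suc ℓ) (a ∷ A) (b ∷ s) rewrite insert⊆ᵇ ℓ A s with not a ∨ b
  ... | true  = refl
  ... | false with lookup s ℓ
  ...   | true  = refl
  ...   | false = refl

  ⊆ᵇ-lookup : ∀ {N} (A s : Subset N) → (A ⊆ᵇ s) ≡ true → ∀ i → lookup A i ≡ true → lookup s i ≡ true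
  ⊆ᵇ-lookup (true ∷ A)  (true ∷ s)  _   zero    _ = refl
  ⊆ᵇ-lookup (a ∷ A)     (b ∷ s)     A⊆s (suc i) e with not a ∨ b
  ⊆ᵇ-lookup (a ∷ A)     (b ∷ s)     A⊆s (suc i) e | true = ⊆ᵇ-lookup A s A⊆s i e

  size-pair : ∀ {N} (i j : Fin N) → i ≢ j → size (pair i j) ≡ 2
  size-pair {N} i j i≢j =
    trans (size-insert i (insert j ∅) i∉j) (cong suc (trans (size-insert j ∅ (lookup-∅ j)) (cong suc (size-∅ {N}))))
    where
    i∉j : lookup (insert j (∅ {N})) i ≡ false
    i∉j = trans (lookup-insert j ∅ i) (trans (cong (_∨ lookup (∅ {N}) i) (≢⇒==-false i j i≢j)) (lookup-∅ i))

  pair⊆ᵇ : ∀ {N} (i j : Fin N) (s : Subset N) → (pair i j ⊆ᵇ s) ≡ (lookup s i ∧ (lookup s j ∧ true))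
  pair⊆ᵇ i j s = trans (insert⊆ᵇ i (insert j ∅) s)
                       (cong (lookup s i ∧_) (trans (insert⊆ᵇ j ∅ s) (cong (lookup s j ∧_) (∅⊆ᵇ s))))

  countOutside : ∀ {N} → Subset N → Subset N → ℕ
  countOutside A s = count (λ ℓ → lookup s ℓ ∧ not (lookup A ℓ))

  size-⊆ᵇ : ∀ {N} (A s : Subset N) → (A ⊆ᵇ s) ≡ true → size s ≡ size A + countOutside A s
  size-⊆ᵇ []          []          _   = refl
  size-⊆ᵇ (true ∷ A)  (true ∷ s)  A⊆s = cong suc (size-⊆ᵇ A s A⊆s)
  size-⊆ᵇ (false ∷ A) (true ∷ s)  A⊆s = trans (cong suc (size-⊆ᵇ A s A⊆s)) (sym (+-suc (size A) (countOutside A s)))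
  size-⊆ᵇ (false ∷ A) (false ∷ s) A⊆s = size-⊆ᵇ A s A⊆s

  sumSubsets : ∀ {N} → (Subset N → ℕ) → ℕ
  sumSubsets {zero}  g = g []
  sumSubsets {suc N} g = sumSubsets (λ s → g (false ∷ s)) + sumSubsets (λ s → g (true ∷ s))

  sumSubsets-cong : ∀ {N} {g h : Subset N → ℕ} → (∀ s → g s ≡ h s) → sumSubsets g ≡ sumSubsets h
  sumSubsets-cong {zero}  g≡h = g≡h []
  sumSubsets-cong {suc N} g≡h =
    cong₂ _+_ (sumSubsets-cong (λ s → g≡h (false ∷ s))) (sumSubsets-cong (λ s → g≡h (true ∷ s)))

  sumSubsets-zero : ∀ {N} (g : Subset N → ℕ) → (∀ s → g s ≡ 0) → sumSubsets g ≡ 0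
  sumSubsets-zero {zero}  g g≡0 = g≡0 []
  sumSubsets-zero {suc N} g g≡0 =
    cong₂ _+_ (sumSubsets-zero _ (λ s → g≡0 (false ∷ s))) (sumSubsets-zero _ (λ s → g≡0 (true ∷ s)))

  *-distribˡ-sumSubsets : ∀ {N} k (g : Subset N → ℕ) → sumSubsets (λ s → k * g s) ≡ k * sumSubsets g
  *-distribˡ-sumSubsets {zero}  k g = refl
  *-distribˡ-sumSubsets {suc N} k g =
    trans (cong₂ _+_ (*-distribˡ-sumSubsets k (λ s → g (false ∷ s))) (*-distribˡ-sumSubsets k (λ s → g (true ∷ s))))
          (sym (*-distribˡ-+ k _ _))

  sumSubsets-sum : ∀ {N a} (h : Subset N → Fin a → ℕ) →
    sumSubsets (λ s → sum (h s)) ≡ sum (λ ℓ → sumSubsets (λ s → h s ℓ))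
  sumSubsets-sum {zero}  h = refl
  sumSubsets-sum {suc N} h =
    trans (cong₂ _+_ (sumSubsets-sum (λ s → h (false ∷ s))) (sumSubsets-sum (λ s → h (true ∷ s))))
          (sym (∑-distrib-+ (λ ℓ → sumSubsets (λ s → h (false ∷ s) ℓ)) (λ ℓ → sumSubsets (λ s → h (true ∷ s) ℓ))))

  sumSubsets-size0 : ∀ {N} (g : Subset N → ℕ) → sumSubsets (λ s → 𝟙 (size s ≡ᵇ 0) * g s) ≡ g ∅
  sumSubsets-size0 {zero}  g = +-identityʳ (g [])
  sumSubsets-size0 {suc N} g = begin
    sumSubsets (λ s → 𝟙 (size s ≡ᵇ 0) * g (false ∷ s)) + sumSubsets {N} (λ _ → 0)
      ≡⟨ cong₂ _+_ (sumSubsets-size0 (λ s → g (false ∷ s))) (sumSubsets-zero {N} _ (λ _ → refl)) ⟩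
    g ∅ + 0 ≡⟨ +-identityʳ _ ⟩
    g ∅     ∎
    where open ≡-Reasoning

  ≡ᵇ⇒≡′ : ∀ m n → (m ≡ᵇ n) ≡ true → m ≡ n
  ≡ᵇ⇒≡′ m n e = ≡ᵇ⇒≡ m n (subst T (sym e) _)

  ≢⇒≡ᵇ-false : ∀ m n → m ≢ n → (m ≡ᵇ n) ≡ false
  ≢⇒≡ᵇ-false m n m≢n with m ≡ᵇ n in e
  ... | true  = ⊥-elim (m≢n (≡ᵇ⇒≡′ m n e))
  ... | false = refl

  ⊆ᵇ⇒size≤ : ∀ {N} (A s : Subset N) → (A ⊆ᵇ s) ≡ true → size A ≤ size s
  ⊆ᵇ⇒size≤ A s A⊆s = ≤-trans (m≤m+n (size A) (countOutside A s)) (≤-reflexive (sym (size-⊆ᵇ A s A⊆s)))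

  sumSubsets-supersetsOfSameSize : ∀ {N} (A : Subset N) (g : Subset N → ℕ) →
    sumSubsets (λ s → 𝟙 ((A ⊆ᵇ s) ∧ (size s ≡ᵇ size A)) * g s) ≡ g A
  sumSubsets-supersetsOfSameSize []           g = +-identityʳ (g [])
  sumSubsets-supersetsOfSameSize {suc N} (true ∷ A) g =
    trans (cong (_+ sumSubsets (λ s → 𝟙 ((A ⊆ᵇ s) ∧ (size s ≡ᵇ size A)) * g (true ∷ s)))
                (sumSubsets-zero {N} (λ _ → 0) (λ _ → refl)))
          (sumSubsets-supersetsOfSameSize A (λ s → g (true ∷ s)))
  sumSubsets-supersetsOfSameSize (false ∷ A) g =
    trans (cong₂ _+_ (sumSubsets-supersetsOfSameSize A (λ s → g (false ∷ s))) (sumSubsets-zero _ too-big))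
          (+-identityʳ _)
    where
    too-big : ∀ s → 𝟙 ((A ⊆ᵇ s) ∧ (suc (size s) ≡ᵇ size A)) * g (true ∷ s) ≡ 0
    too-big s with A ⊆ᵇ s in A⊆s
    ... | false = refl
    ... | true rewrite ≢⇒≡ᵇ-false (suc (size s)) (size A)
                         (λ e → 1+n≰n (subst (_≤ size s) (sym e) (⊆ᵇ⇒size≤ A s A⊆s))) = refl

  supersetCount : ∀ {N} → ℕ → Subset N → (Subset N → Bool) → ℕ
  supersetCount k A I = sumSubsets (λ s → 𝟙 ((A ⊆ᵇ s) ∧ ((size s ≡ᵇ k + size A) ∧ I s)))

  supersetCount-zero : ∀ {N} (A : Subset N) (I : Subset N → Bool) → supersetCount 0 A I ≡ 𝟙 (I A)
  supersetCount-zero A I = trans (sumSubsets-cong reassoc) (sumSubsets-supersetsOfSameSize A (𝟙 ∘ I))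
    where
    reassoc : ∀ s → 𝟙 ((A ⊆ᵇ s) ∧ ((size s ≡ᵇ size A) ∧ I s)) ≡ 𝟙 ((A ⊆ᵇ s) ∧ (size s ≡ᵇ size A)) * 𝟙 (I s)
    reassoc s = trans (cong 𝟙 (sym (∧-assoc (A ⊆ᵇ s) _ _))) (𝟙-∧ _ (I s))

  -- Double counting of the pairs (s, ℓ) with ℓ ∈ s ∖ A.
  supersetCount-suc : ∀ {N} k (A : Subset N) (I : Subset N → Bool) →
    suc k * supersetCount (suc k) A I ≡ sum (λ ℓ → 𝟙 (not (lookup A ℓ)) * supersetCount k (insert ℓ A) I)
  supersetCount-suc {N} k A I = begin
    suc k * supersetCount (suc k) A I                  ≡⟨ *-distribˡ-sumSubsets (suc k) (𝟙 ∘ Φ) ⟨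
    sumSubsets (λ s → suc k * 𝟙 (Φ s))                 ≡⟨ sumSubsets-cong choices ⟩
    sumSubsets (λ s → sum (λ ℓ → 𝟙 (new s ℓ) * 𝟙 (Φ s))) ≡⟨ sumSubsets-sum (λ s ℓ → 𝟙 (new s ℓ) * 𝟙 (Φ s)) ⟩
    sum (λ ℓ → sumSubsets (λ s → 𝟙 (new s ℓ) * 𝟙 (Φ s))) ≡⟨ sum-cong-≗ extendBy ⟩
    sum (λ ℓ → 𝟙 (not (lookup A ℓ)) * supersetCount k (insert ℓ A) I) ∎
    where
    open ≡-Reasoning
    Φ : Subset N → Bool
    Φ s = (A ⊆ᵇ s) ∧ ((size s ≡ᵇ suc k + size A) ∧ I s)
    new : Subset N → Fin N → Bool
    new s ℓ = lookup s ℓ ∧ not (lookup A ℓ)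

    outside : ∀ s → Φ s ≡ true → suc k ≡ countOutside A s
    outside s Φs with A ⊆ᵇ s in A⊆s | size s ≡ᵇ suc k + size A in sizeₛ
    ... | true | true = +-cancelˡ-≡ (size A) _ _ (begin
      size A + suc k ≡⟨ +-comm (size A) (suc k) ⟩
      suc k + size A ≡⟨ ≡ᵇ⇒≡′ _ _ sizeₛ ⟨
      size s         ≡⟨ size-⊆ᵇ A s A⊆s ⟩
      size A + countOutside A s ∎)

    choices : ∀ s → suc k * 𝟙 (Φ s) ≡ sum (λ ℓ → 𝟙 (new s ℓ) * 𝟙 (Φ s))
    choices s with Φ s in Φs
    ... | false = trans (*-zeroʳ (suc k)) (sym (sum-zero _ (λ ℓ → *-zeroʳ (𝟙 (new s ℓ)))))
    ... | true  = trans (cong (_* 1) (outside s Φs)) (sym (*-distribʳ-sum (𝟙 ∘ new s) 1))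

    extendBy : ∀ ℓ → sumSubsets (λ s → 𝟙 (new s ℓ) * 𝟙 (Φ s)) ≡ 𝟙 (not (lookup A ℓ)) * supersetCount k (insert ℓ A) I
    extendBy ℓ with lookup A ℓ in ℓ∈A
    ... | true  = sumSubsets-zero _ (λ s → cong (λ b → 𝟙 b * 𝟙 (Φ s)) (∧-zeroʳ (lookup s ℓ)))
    ... | false = trans (sumSubsets-cong same) (sym (+-identityʳ _))
      where
      same : ∀ s → 𝟙 (lookup s ℓ ∧ true) * 𝟙 (Φ s)
                 ≡ 𝟙 ((insert ℓ A ⊆ᵇ s) ∧ ((size s ≡ᵇ k + size (insert ℓ A)) ∧ I s))
      same s rewrite ∧-identityʳ (lookup s ℓ) | insert⊆ᵇ ℓ A s | size-insert ℓ A ℓ∈A | +-suc k (size A)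
        with lookup s ℓ
      ... | true  = +-identityʳ _
      ... | false = refl

  supportedIn : ∀ {q N} (z : Fin q) → Subset N → (Fin N → Fin q) → Bool
  supportedIn z []      f = true
  supportedIn z (a ∷ A) f = (a ∨ (f zero == z)) ∧ supportedIn z A (f ∘ suc)

  supportedIn-cong : ∀ {q N} (z : Fin q) (A : Subset N) {f g : Fin N → Fin q} →
    (∀ i → f i ≡ g i) → supportedIn z A f ≡ supportedIn z A g
  supportedIn-cong z []      f≡g = refl
  supportedIn-cong z (a ∷ A) f≡g =
    cong₂ _∧_ (cong (λ x → a ∨ (x == z)) (f≡g zero)) (supportedIn-cong z A (f≡g ∘ suc))

  count-supportedIn : ∀ {q} (z : Fin q) N (A : Subset N) →
    count {q ^ N} (supportedIn z A ∘ finToFun) ≡ q ^ size A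
  count-supportedIn z zero    []      = refl
  count-supportedIn {q} z (suc N) (a ∷ A) = begin
    sum {q ^ suc N} (λ y → 𝟙 (supportedIn z (a ∷ A) (finToFun y)))
      ≡⟨ sum-combine q (q ^ N) _ ⟩
    sum {q} (λ i → sum {q ^ N} (λ y → 𝟙 (supportedIn z (a ∷ A) (finToFun {q} {suc N} (combine i y)))))
      ≡⟨ sum-cong-≗ (λ i → sum-cong-≗ (λ y → trans (cong 𝟙 (split i y)) (𝟙-∧ (a ∨ (i == z)) _))) ⟩
    sum {q} (λ i → sum {q ^ N} (λ y → 𝟙 (a ∨ (i == z)) * 𝟙 (supportedIn z A (finToFun y))))
      ≡⟨ sum-cong-≗ (λ i → *-distribˡ-sum (𝟙 (a ∨ (i == z))) (λ y → 𝟙 (supportedIn z A (finToFun {q} {N} y)))) ⟨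
    sum {q} (λ i → 𝟙 (a ∨ (i == z)) * count {q ^ N} (supportedIn z A ∘ finToFun))
      ≡⟨ trans (*-distribʳ-sum (λ i → 𝟙 (a ∨ (i == z))) (count {q ^ N} (supportedIn z A ∘ finToFun)))
               (cong (count (λ i → a ∨ (i == z)) *_) (count-supportedIn z N A)) ⟩
    count (λ i → a ∨ (i == z)) * q ^ size A
      ≡⟨ cong (_* q ^ size A) (firstCoordinate a) ⟩
    q ^ 𝟙 a * q ^ size A
      ≡⟨ ^-distribˡ-+-* q (𝟙 a) (size A) ⟨
    q ^ (𝟙 a + size A) ∎
    where
    open ≡-Reasoning
    split : ∀ i y → supportedIn z (a ∷ A) (finToFun {q} {suc N} (combine i y))
                  ≡ (a ∨ (i == z)) ∧ supportedIn z A (finToFun y)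
    split i y rewrite finToFun-combine-zero {q} {N} i y =
      cong ((a ∨ (i == z)) ∧_) (supportedIn-cong z A (finToFun-combine-suc {q} {N} i y))
    firstCoordinate : ∀ a → count (λ i → a ∨ (i == z)) ≡ q ^ 𝟙 a
    firstCoordinate true  = sum-const {q} 1
    firstCoordinate false = count-== z

  risingProduct : (ℕ → ℕ) → ℕ → ℕ → ℕ
  risingProduct L zero    d = 1
  risingProduct L (suc k) d = L d * risingProduct L k (suc d)

module IncreasingTuples where

  open import Defs using (increasing; monomialExp)
  open import Data.Nat using (ℕ; zero; suc; _+_; _*_; _∸_; _≡ᵇ_)
  open import Data.Nat.Properties using (+-identityʳ; +-comm)
  open import Data.Nat.ListAction using () renaming (sum to sumList)
  open import Data.Nat.ListAction.Properties using () renaming (sum-++ to sumList-++)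
  open import Data.Fin using (Fin; zero; suc)
  import Data.Fin as Fin
  open import Data.Fin.Properties using (_≟_)
  open import Data.Bool using (true; false; if_then_else_)
  open import Data.Vec using (Vec; []; _∷_; lookup)
  import Data.Vec as Vec
  open import Data.List using (List; []; _∷_; _++_)
  import Data.List as List
  open import Data.List.Properties using (map-++; map-∘; map-cong)
  open import Data.List.Relation.Unary.All using (All; []; _∷_)
  import Data.List.Relation.Unary.All as All
  import Data.List.Relation.Unary.All.Properties as All
  open import Data.Product using (∃; _,_)
  open import Function using (_∘_)
  open import Relation.Nullary using (yes; no)
  open import Relation.Nullary.Decidable using (⌊_⌋)
  open import Data.Empty using (⊥-elim)
  open import Relation.Binary.PropositionalEquality

  open Counting
  open Subsets

  data Increasing : (k N : ℕ) → Vec (Fin N) k → Set where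
    nil  : ∀ {N} → Increasing 0 N []
    take : ∀ {k N t} → Increasing k N t → Increasing (suc k) (suc N) (zero ∷ Vec.map suc t)
    skip : ∀ {k N t} → Increasing (suc k) N t → Increasing (suc k) (suc N) (Vec.map suc t)

  increasing-Increasing : ∀ k N → All (Increasing k N) (increasing k N)
  increasing-Increasing zero    N       = nil ∷ []
  increasing-Increasing (suc k) zero    = []
  increasing-Increasing (suc k) (suc N) =
    All.++⁺ (All.map⁺ (All.map take (increasing-Increasing k N)))
            (All.map⁺ (All.map skip (increasing-Increasing (suc k) N)))

  toSubset : ∀ {k N} → Vec (Fin N) k → Subset N
  toSubset []      = ∅
  toSubset (x ∷ t) = insert x (toSubset t)

  toSubset-map-suc : ∀ {k N} (t : Vec (Fin N) k) → toSubset (Vec.map suc t) ≡ false ∷ toSubset t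
  toSubset-map-suc []      = refl
  toSubset-map-suc (x ∷ t) rewrite toSubset-map-suc t = refl

  lookup-map-suc : ∀ {k N} (t : Vec (Fin N) k) i → lookup (Vec.map (Fin.suc {N}) t) i ≡ Fin.suc (lookup t i)
  lookup-map-suc (x ∷ t) zero    = refl
  lookup-map-suc (x ∷ t) (suc i) = lookup-map-suc t i

  sumList-map-All : ∀ {A : Set} (f g : A → ℕ) (xs : List A) →
    All (λ x → f x ≡ g x) xs → sumList (List.map f xs) ≡ sumList (List.map g xs)
  sumList-map-All f g []       []         = refl
  sumList-map-All f g (x ∷ xs) (e ∷ es) = cong₂ _+_ e (sumList-map-All f g xs es)

  sum-increasing : ∀ k N (G : Subset N → ℕ) →
    sumList (List.map (G ∘ toSubset) (increasing k N)) ≡ sumSubsets (λ s → 𝟙 (size s ≡ᵇ k) * G s)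
  sum-increasing zero    N       G = trans (+-identityʳ (G ∅)) (sym (sumSubsets-size0 G))
  sum-increasing (suc k) zero    G = refl
  sum-increasing (suc k) (suc N) G = begin
    sumList (List.map (G ∘ toSubset) (List.map taken (increasing k N) ++ List.map (Vec.map suc) (increasing (suc k) N)))
      ≡⟨ cong sumList (map-++ (G ∘ toSubset) (List.map taken (increasing k N)) _) ⟩
    sumList (List.map (G ∘ toSubset) (List.map taken (increasing k N))
             ++ List.map (G ∘ toSubset) (List.map (Vec.map suc) (increasing (suc k) N)))
      ≡⟨ sumList-++ (List.map (G ∘ toSubset) (List.map taken (increasing k N))) _ ⟩
    sumList (List.map (G ∘ toSubset) (List.map taken (increasing k N)))
      + sumList (List.map (G ∘ toSubset) (List.map (Vec.map suc) (increasing (suc k) N)))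
      ≡⟨ cong₂ _+_ (cong sumList (trans (sym (map-∘ (increasing k N))) (map-cong inTaken (increasing k N))))
                   (cong sumList (trans (sym (map-∘ (increasing (suc k) N))) (map-cong inSkipped (increasing (suc k) N)))) ⟩
    sumList (List.map ((λ s → G (true ∷ s)) ∘ toSubset) (increasing k N))
      + sumList (List.map ((λ s → G (false ∷ s)) ∘ toSubset) (increasing (suc k) N))
      ≡⟨ cong₂ _+_ (sum-increasing k N (λ s → G (true ∷ s))) (sum-increasing (suc k) N (λ s → G (false ∷ s))) ⟩
    sumSubsets (λ s → 𝟙 (size s ≡ᵇ k) * G (true ∷ s)) + sumSubsets (λ s → 𝟙 (size s ≡ᵇ suc k) * G (false ∷ s))
      ≡⟨ +-comm (sumSubsets (λ s → 𝟙 (size s ≡ᵇ k) * G (true ∷ s))) _ ⟩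
    sumSubsets (λ s → 𝟙 (size s ≡ᵇ suc k) * G (false ∷ s)) + sumSubsets (λ s → 𝟙 (size s ≡ᵇ k) * G (true ∷ s)) ∎
    where
    open ≡-Reasoning
    taken : Vec (Fin N) k → Vec (Fin (suc N)) (suc k)
    taken t = zero ∷ Vec.map suc t
    inTaken : ∀ t → G (toSubset (taken t)) ≡ G (true ∷ toSubset t)
    inTaken t rewrite toSubset-map-suc t = refl
    inSkipped : ∀ t → G (toSubset (Vec.map suc t)) ≡ G (false ∷ toSubset t)
    inSkipped t rewrite toSubset-map-suc t = refl

  Increasing-lookup : ∀ {k N t} → Increasing k N t → ∀ j → lookup (toSubset t) j ≡ true → ∃ λ i → lookup t i ≡ j
  Increasing-lookup nil j e with () ← trans (sym (lookup-∅ j)) e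
  Increasing-lookup (take I) zero e = zero , refl
  Increasing-lookup (take {t = t} I) (suc j) e rewrite toSubset-map-suc t with Increasing-lookup I j e
  ... | i , tᵢ≡j = suc i , trans (lookup-map-suc t i) (cong suc tᵢ≡j)
  Increasing-lookup (skip {t = t} I) zero e rewrite toSubset-map-suc t with () ← e
  Increasing-lookup (skip {t = t} I) (suc j) e rewrite toSubset-map-suc t with Increasing-lookup I j e
  ... | i , tᵢ≡j = i , trans (lookup-map-suc t i) (cong suc tᵢ≡j)

  monomialExp-map-suc-zero : ∀ {k N} (t : Vec (Fin N) k) → monomialExp (Vec.map suc t) zero ≡ 0
  monomialExp-map-suc-zero []      = refl
  monomialExp-map-suc-zero (x ∷ t) = monomialExp-map-suc-zero t

  monomialExp-map-suc : ∀ {k N} (t : Vec (Fin N) k) j → monomialExp (Vec.map suc t) (suc j) ≡ monomialExp t j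
  monomialExp-map-suc []      j = refl
  monomialExp-map-suc (x ∷ t) j with x ≟ j
  ... | yes refl = cong suc (monomialExp-map-suc t j)
  ... | no  x≢j  = monomialExp-map-suc t j

  monomialExp-Increasing : ∀ {k N t} → Increasing k N t → ∀ j → monomialExp t j ≡ 𝟙 (lookup (toSubset t) j)
  monomialExp-Increasing nil j rewrite lookup-∅ j = refl
  monomialExp-Increasing (take {t = t} I) zero    rewrite toSubset-map-suc t = cong suc (monomialExp-map-suc-zero t)
  monomialExp-Increasing (take {t = t} I) (suc j) rewrite toSubset-map-suc t =
    trans (monomialExp-map-suc t j) (monomialExp-Increasing I j)
  monomialExp-Increasing (skip {t = t} I) zero    rewrite toSubset-map-suc t = monomialExp-map-suc-zero t
  monomialExp-Increasing (skip {t = t} I) (suc j) rewrite toSubset-map-suc t =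
    trans (monomialExp-map-suc t j) (monomialExp-Increasing I j)

  -- ∂²/∂Xᵢ∂Xⱼ of the monomial with exponent vector α, evaluated at 1
  ∂∂-coefficient : ∀ {N} → Fin N → Fin N → (Fin N → ℕ) → ℕ
  ∂∂-coefficient i j α = α j * (if ⌊ i ≟ j ⌋ then α j ∸ 1 else α i)

  ∂∂-coefficient-diagonal : ∀ {k N t} → Increasing k N t → ∀ i → ∂∂-coefficient i i (monomialExp t) ≡ 0
  ∂∂-coefficient-diagonal {t = t} I i with i ≟ i
  ... | no  i≢i = ⊥-elim (i≢i refl)
  ... | yes _ rewrite monomialExp-Increasing I i = 𝟙*pred𝟙≡0 (lookup (toSubset t) i)
    where
    𝟙*pred𝟙≡0 : ∀ b → 𝟙 b * (𝟙 b ∸ 1) ≡ 0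
    𝟙*pred𝟙≡0 true  = refl
    𝟙*pred𝟙≡0 false = refl

  ∂∂-coefficient-offDiagonal : ∀ {k N t} → Increasing k N t → ∀ i j → i ≢ j →
    ∂∂-coefficient i j (monomialExp t) ≡ 𝟙 (lookup (toSubset t) j) * 𝟙 (lookup (toSubset t) i)
  ∂∂-coefficient-offDiagonal {t = t} I i j i≢j with i ≟ j
  ... | yes i≡j = ⊥-elim (i≢j i≡j)
  ... | no  _ rewrite monomialExp-Increasing I j | monomialExp-Increasing I i = refl

module FieldFacts {a ℓ} (K : Field a ℓ) where

  open import Defs using (Field)
  open import Data.Nat using (ℕ; zero; suc)
  import Data.Nat as ℕ
  open import Data.Fin using (Fin; zero; suc; punchIn)
  open import Data.Fin.Properties using (punchInᵢ≢i)
  open import Data.Maybe using (nothing)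
  open import Function using (_∘_)
  open import Relation.Binary.PropositionalEquality using (_≢_)
  open import Relation.Nullary using (¬_)
  open import Tactic.RingSolver.Core.AlmostCommutativeRing using (AlmostCommutativeRing; fromCommutativeRing)

  open Field K
  open import Algebra.Properties.Ring ring public
    using (-‿distribˡ-*; -‿distribʳ-*; -‿involutive; -‿anti-homo-+; -0#≈0#; -‿+-comm; x∙y⁻¹≈ε⇒x≈y)
  private
    almostCommutativeRing : AlmostCommutativeRing a ℓ
    almostCommutativeRing = fromCommutativeRing commutativeRing (λ _ → nothing)

  open import Tactic.RingSolver.NonReflective almostCommutativeRing public
    using (solve; _⊜_; _⊕_; _⊗_)
  open import Relation.Binary.Reasoning.Setoid setoid

  -x*-y≈x*y : ∀ x y → (- x) * (- y) ≈ x * y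
  -x*-y≈x*y x y = begin
    (- x) * (- y) ≈⟨ -‿distribˡ-* x (- y) ⟨
    - (x * - y)   ≈⟨ -‿cong (-‿distribʳ-* x y) ⟨
    - (- (x * y)) ≈⟨ -‿involutive _ ⟩
    x * y         ∎

  x*y≈0⇒y≈0 : ∀ x y → ¬ (x ≈ 0#) → x * y ≈ 0# → y ≈ 0#
  x*y≈0⇒y≈0 x y x≉0 xy≈0 = begin
    y                   ≈⟨ *-identityˡ y ⟨
    1# * y              ≈⟨ *-congʳ (trans (*-comm _ _) (inv-cancel x x≉0)) ⟨
    (inv x x≉0 * x) * y ≈⟨ *-assoc _ _ _ ⟩
    inv x x≉0 * (x * y) ≈⟨ *-congˡ xy≈0 ⟩
    inv x x≉0 * 0#      ≈⟨ zeroʳ _ ⟩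
    0#                  ∎

  sumF-cong : ∀ {m} {f g : Fin m → Carrier} → (∀ k → f k ≈ g k) → sumF f ≈ sumF g
  sumF-cong {zero}  f≈g = refl
  sumF-cong {suc m} f≈g = +-cong (f≈g zero) (sumF-cong (f≈g ∘ suc))

  sumF-zero : ∀ {m} → sumF {m} (λ _ → 0#) ≈ 0#
  sumF-zero {zero}  = refl
  sumF-zero {suc m} = trans (+-identityˡ _) (sumF-zero {m})

  sumF-+ : ∀ {m} (f g : Fin m → Carrier) → sumF (λ i → f i + g i) ≈ sumF f + sumF g
  sumF-+ {zero}  f g = sym (+-identityˡ 0#)
  sumF-+ {suc m} f g = begin
    (f zero + g zero) + sumF (λ i → f (suc i) + g (suc i))
      ≈⟨ +-congˡ (sumF-+ (f ∘ suc) (g ∘ suc)) ⟩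
    (f zero + g zero) + (sumF (f ∘ suc) + sumF (g ∘ suc))
      ≈⟨ solve 4 (λ a b c d → ((a ⊕ b) ⊕ (c ⊕ d)) ⊜ ((a ⊕ c) ⊕ (b ⊕ d))) refl _ _ _ _ ⟩
    (f zero + sumF (f ∘ suc)) + (g zero + sumF (g ∘ suc)) ∎

  *-distribˡ-sumF : ∀ {m} x (f : Fin m → Carrier) → sumF (λ i → x * f i) ≈ x * sumF f
  *-distribˡ-sumF {zero}  x f = sym (zeroʳ x)
  *-distribˡ-sumF {suc m} x f =
    trans (+-congˡ (*-distribˡ-sumF x (f ∘ suc))) (sym (distribˡ x _ _))

  -‿distrib-sumF : ∀ {m} (f : Fin m → Carrier) → sumF (λ i → - f i) ≈ - sumF f
  -‿distrib-sumF {zero}  f = sym -0#≈0#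
  -‿distrib-sumF {suc m} f = begin
    - f zero + sumF (λ i → - f (suc i)) ≈⟨ +-congˡ (-‿distrib-sumF (f ∘ suc)) ⟩
    - f zero + - sumF (f ∘ suc)         ≈⟨ -‿anti-homo-+ _ _ ⟨
    - (sumF (f ∘ suc) + f zero)         ≈⟨ -‿cong (+-comm _ _) ⟩
    - (f zero + sumF (f ∘ suc))         ∎

  sumF-comm : ∀ {m n} (f : Fin m → Fin n → Carrier) →
    sumF (λ i → sumF (λ j → f i j)) ≈ sumF (λ j → sumF (λ i → f i j))
  sumF-comm {zero}  {n} f = sym (sumF-zero {n})
  sumF-comm {suc m} f = begin
    sumF (f zero) + sumF (λ i → sumF (λ j → f (suc i) j)) ≈⟨ +-congˡ (sumF-comm (f ∘ suc)) ⟩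
    sumF (f zero) + sumF (λ j → sumF (λ i → f (suc i) j)) ≈⟨ sumF-+ (f zero) (λ j → sumF (λ i → f (suc i) j)) ⟨
    sumF (λ j → f zero j + sumF (λ i → f (suc i) j))       ∎

  sumF-punchIn : ∀ {m} (j : Fin (suc m)) (h : Fin (suc m) → Carrier) → sumF h ≈ h j + sumF (h ∘ punchIn j)
  sumF-punchIn zero h = refl
  sumF-punchIn {suc m} (suc j) h = begin
    h zero + sumF (h ∘ suc)                           ≈⟨ +-congˡ (sumF-punchIn j (h ∘ suc)) ⟩
    h zero + (h (suc j) + sumF (h ∘ suc ∘ punchIn j))
      ≈⟨ solve 3 (λ a b c → (a ⊕ (b ⊕ c)) ⊜ (b ⊕ (a ⊕ c))) refl _ _ _ ⟩
    h (suc j) + (h zero + sumF (h ∘ suc ∘ punchIn j)) ∎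

  sumF-single : ∀ {m} (h : Fin m → Carrier) (j : Fin m) → (∀ i → i ≢ j → h i ≈ 0#) → sumF h ≈ h j
  sumF-single {suc m} h j h≈0 = begin
    sumF h                     ≈⟨ sumF-punchIn j h ⟩
    h j + sumF (h ∘ punchIn j) ≈⟨ +-congˡ (sumF-cong (λ k → h≈0 (punchIn j k) (punchInᵢ≢i j k))) ⟩
    h j + sumF {m} (λ _ → 0#)  ≈⟨ +-congˡ (sumF-zero {m}) ⟩
    h j + 0#                   ≈⟨ +-identityʳ _ ⟩
    h j                        ∎

  fromℕ-+ : ∀ m n → fromℕ (m ℕ.+ n) ≈ fromℕ m + fromℕ n
  fromℕ-+ zero    n = sym (+-identityˡ _)
  fromℕ-+ (suc m) n = trans (+-congˡ (fromℕ-+ m n)) (sym (+-assoc _ _ _))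

  fromℕ-* : ∀ m n → fromℕ (m ℕ.* n) ≈ fromℕ m * fromℕ n
  fromℕ-* zero    n = sym (zeroˡ _)
  fromℕ-* (suc m) n = begin
    fromℕ (n ℕ.+ m ℕ.* n)            ≈⟨ fromℕ-+ n (m ℕ.* n) ⟩
    fromℕ n + fromℕ (m ℕ.* n)        ≈⟨ +-congˡ (fromℕ-* m n) ⟩
    fromℕ n + fromℕ m * fromℕ n      ≈⟨ +-congʳ (*-identityˡ _) ⟨
    1# * fromℕ n + fromℕ m * fromℕ n ≈⟨ distribʳ _ _ _ ⟨
    (1# + fromℕ m) * fromℕ n         ∎

  x*y+z≈0⇒y≈-x⁻¹*z : ∀ x y z (x≉0 : ¬ (x ≈ 0#)) → x * y + z ≈ 0# → y ≈ (- inv x x≉0) * z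
  x*y+z≈0⇒y≈-x⁻¹*z x y z x≉0 xy+z≈0 = begin
    y                          ≈⟨ *-identityˡ y ⟨
    1# * y                     ≈⟨ *-congʳ (trans (*-comm _ _) (inv-cancel x x≉0)) ⟨
    (x⁻¹ * x) * y              ≈⟨ *-assoc _ _ _ ⟩
    x⁻¹ * (x * y)              ≈⟨ *-congˡ (x∙y⁻¹≈ε⇒x≈y (x * y) (- z) (trans (+-congˡ (-‿involutive z)) xy+z≈0)) ⟩
    x⁻¹ * (- z)                ≈⟨ -‿distribʳ-* x⁻¹ z ⟨
    - (x⁻¹ * z)                ≈⟨ -‿distribˡ-* x⁻¹ z ⟩
    (- x⁻¹) * z                ∎
    where x⁻¹ = inv x x≉0

  x*y≈z⇒y≈z*x⁻¹ : ∀ x y z (x≉0 : ¬ (x ≈ 0#)) → x * y ≈ z → y ≈ z * inv x x≉0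
  x*y≈z⇒y≈z*x⁻¹ x y z x≉0 xy≈z = begin
    y                          ≈⟨ *-identityʳ y ⟨
    y * 1#                     ≈⟨ *-congˡ (inv-cancel x x≉0) ⟨
    y * (x * inv x x≉0)        ≈⟨ *-assoc y x _ ⟨
    (y * x) * inv x x≉0        ≈⟨ *-congʳ (trans (*-comm y x) xy≈z) ⟩
    z * inv x x≉0              ∎

module Determinant {a ℓ} (K : Field a ℓ) where

  open import Defs using (Field; module PolyOps)
  open import Data.Nat using (ℕ; zero; suc)
  import Data.Nat as ℕ
  open import Data.Fin using (Fin; zero; suc; punchIn; punchOut; inject₁; toℕ)
  open import Data.Fin.Properties
    using (_≟_; punchOut-punchIn; punchInᵢ≢i; punchOut-cong; punchIn-punchOut; toℕ-inject₁)
  open import Data.Bool using (true; false; if_then_else_)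
  open import Data.List using (List; []; _∷_; map)
  open import Data.Product using (_×_; proj₁; proj₂)
  open import Data.Sum using (_⊎_; inj₁; inj₂)
  import Data.Sum as Sum
  open import Data.Empty using (⊥-elim)
  open import Function using (_∘_)
  open import Relation.Nullary using (yes; no; ¬_)
  import Relation.Binary.PropositionalEquality as ≡
  open ≡ using (_≡_; _≢_)

  open Counting using (_==_; ==-refl; ==⇒≡; ==-false⇒≢; suc==inject₁)

  open Field K
  open PolyOps K using (det; altSum)
  open FieldFacts K
  open import Relation.Binary.Reasoning.Setoid setoid
  import Algebra.Solver.CommutativeMonoid *-commutativeMonoid as *-Solver
  open *-Solver using () renaming (_⊕_ to _⊛_; _⊜_ to _⊜ₘ_)

  Matrix : ℕ → Set a
  Matrix m = Fin m → Fin m → Carrier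

  minor : ∀ {m} → Fin (suc m) → Matrix (suc m) → Matrix m
  minor j M r c = M (suc r) (punchIn j c)

  altSum-cong : ∀ {m} {f g : Fin m → Carrier} → (∀ k → f k ≈ g k) → altSum f ≈ altSum g
  altSum-cong {zero}  f≈g = refl
  altSum-cong {suc m} f≈g = +-cong (f≈g zero) (-‿cong (altSum-cong (f≈g ∘ suc)))

  altSum-zero : ∀ {m} (f : Fin m → Carrier) → (∀ k → f k ≈ 0#) → altSum f ≈ 0#
  altSum-zero {zero}  f f≈0 = refl
  altSum-zero {suc m} f f≈0 = begin
    f zero + - altSum (f ∘ suc) ≈⟨ +-cong (f≈0 zero) (-‿cong (altSum-zero (f ∘ suc) (f≈0 ∘ suc))) ⟩
    0# + - 0#                   ≈⟨ -‿inverseʳ 0# ⟩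
    0#                          ∎

  altSum-+ : ∀ {m} (f g : Fin m → Carrier) → altSum (λ j → f j + g j) ≈ altSum f + altSum g
  altSum-+ {zero}  f g = sym (+-identityˡ 0#)
  altSum-+ {suc m} f g = begin
    (f zero + g zero) + - altSum (λ j → f (suc j) + g (suc j))
      ≈⟨ +-congˡ (-‿cong (altSum-+ (f ∘ suc) (g ∘ suc))) ⟩
    (f zero + g zero) + - (altSum (f ∘ suc) + altSum (g ∘ suc))
      ≈⟨ +-congˡ (-‿+-comm _ _) ⟨
    (f zero + g zero) + (- altSum (f ∘ suc) + - altSum (g ∘ suc))
      ≈⟨ solve 4 (λ a b c d → ((a ⊕ b) ⊕ (c ⊕ d)) ⊜ ((a ⊕ c) ⊕ (b ⊕ d))) refl _ _ _ _ ⟩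
    (f zero + - altSum (f ∘ suc)) + (g zero + - altSum (g ∘ suc)) ∎

  *-distribˡ-altSum : ∀ {m} x (f : Fin m → Carrier) → altSum (λ j → x * f j) ≈ x * altSum f
  *-distribˡ-altSum {zero}  x f = sym (zeroʳ x)
  *-distribˡ-altSum {suc m} x f = begin
    x * f zero + - altSum (λ j → x * f (suc j)) ≈⟨ +-congˡ (-‿cong (*-distribˡ-altSum x (f ∘ suc))) ⟩
    x * f zero + - (x * altSum (f ∘ suc))       ≈⟨ +-congˡ (-‿distribʳ-* x _) ⟩
    x * f zero + x * - altSum (f ∘ suc)         ≈⟨ distribˡ x _ _ ⟨
    x * (f zero + - altSum (f ∘ suc))           ∎

  sign : ∀ {m} → Fin m → Carrier
  sign zero    = 1#
  sign (suc i) = - sign i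

  altSum≈sumF-sign : ∀ {m} (f : Fin m → Carrier) → altSum f ≈ sumF (λ j → sign j * f j)
  altSum≈sumF-sign {zero}  f = refl
  altSum≈sumF-sign {suc m} f = begin
    f zero + - altSum (f ∘ suc)                        ≈⟨ +-cong (sym (*-identityˡ _)) (-‿cong (altSum≈sumF-sign (f ∘ suc))) ⟩
    1# * f zero + - sumF (λ j → sign j * f (suc j))    ≈⟨ +-congˡ (-‿distrib-sumF (λ j → sign j * f (suc j))) ⟨
    1# * f zero + sumF (λ j → - (sign j * f (suc j)))  ≈⟨ +-congˡ (sumF-cong (λ j → -‿distribˡ-* (sign j) (f (suc j)))) ⟩
    1# * f zero + sumF (λ j → - sign j * f (suc j))    ∎

  det-cong : ∀ m {M N : Matrix m} → (∀ r c → M r c ≈ N r c) → det m M ≈ det m N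
  det-cong zero    M≈N = refl
  det-cong (suc m) M≈N = altSum-cong (λ j → *-cong (M≈N zero j) (det-cong m (λ r c → M≈N (suc r) (punchIn j c))))

  setRow : ∀ {m} → Fin m → Matrix m → (Fin m → Carrier) → Matrix m
  setRow r M x row c = if row == r then x c else M row c

  det-setRow-+ : ∀ m (r : Fin m) (M : Matrix m) (x y : Fin m → Carrier) →
    det m (setRow r M (λ c → x c + y c)) ≈ det m (setRow r M x) + det m (setRow r M y)
  det-setRow-+ (suc m) zero M x y = begin
    altSum (λ j → (x j + y j) * D j)         ≈⟨ altSum-cong (λ j → distribʳ (D j) (x j) (y j)) ⟩
    altSum (λ j → x j * D j + y j * D j)     ≈⟨ altSum-+ (λ j → x j * D j) (λ j → y j * D j) ⟩
    altSum (λ j → x j * D j) + altSum (λ j → y j * D j) ∎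
    where D = λ j → det m (minor j M)
  det-setRow-+ (suc m) (suc r) M x y = begin
    altSum (λ j → M zero j * det m (setRow r (minor j M) (λ c → x (punchIn j c) + y (punchIn j c))))
      ≈⟨ altSum-cong (λ j → *-congˡ {M zero j} (det-setRow-+ m r (minor j M) (x ∘ punchIn j) (y ∘ punchIn j))) ⟩
    altSum (λ j → M zero j * (X j + Y j)) ≈⟨ altSum-cong (λ j → distribˡ (M zero j) (X j) (Y j)) ⟩
    altSum (λ j → M zero j * X j + M zero j * Y j) ≈⟨ altSum-+ (λ j → M zero j * X j) (λ j → M zero j * Y j) ⟩
    altSum (λ j → M zero j * X j) + altSum (λ j → M zero j * Y j) ∎
    where
    X = λ j → det m (setRow r (minor j M) (x ∘ punchIn j))
    Y = λ j → det m (setRow r (minor j M) (y ∘ punchIn j))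

  det-setRow-* : ∀ m (r : Fin m) (M : Matrix m) (t : Carrier) (x : Fin m → Carrier) →
    det m (setRow r M (λ c → t * x c)) ≈ t * det m (setRow r M x)
  det-setRow-* (suc m) zero M t x = begin
    altSum (λ j → (t * x j) * det m (minor j M)) ≈⟨ altSum-cong (λ j → *-assoc t (x j) (det m (minor j M))) ⟩
    altSum (λ j → t * (x j * det m (minor j M))) ≈⟨ *-distribˡ-altSum t (λ j → x j * det m (minor j M)) ⟩
    t * altSum (λ j → x j * det m (minor j M))   ∎
  det-setRow-* (suc m) (suc r) M t x = begin
    altSum (λ j → M zero j * det m (setRow r (minor j M) (λ c → t * x (punchIn j c))))
      ≈⟨ altSum-cong (λ j → *-congˡ {M zero j} (det-setRow-* m r (minor j M) t (x ∘ punchIn j))) ⟩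
    altSum (λ j → M zero j * (t * X j))
      ≈⟨ altSum-cong (λ j → solve 3 (λ a b c → (a ⊗ (b ⊗ c)) ⊜ (b ⊗ (a ⊗ c))) refl (M zero j) t (X j)) ⟩
    altSum (λ j → t * (M zero j * X j)) ≈⟨ *-distribˡ-altSum t (λ j → M zero j * X j) ⟩
    t * altSum (λ j → M zero j * X j)   ∎
    where X = λ j → det m (setRow r (minor j M) (x ∘ punchIn j))

  det-additive : ∀ m (r : Fin m) (M M₁ M₂ : Matrix m) →
    (∀ row → (row == r) ≡ false → ∀ c → M₁ row c ≈ M row c) →
    (∀ row → (row == r) ≡ false → ∀ c → M₂ row c ≈ M row c) →
    (∀ c → M r c ≈ M₁ r c + M₂ r c) →
    det m M ≈ det m M₁ + det m M₂
  det-additive m r M M₁ M₂ M₁≈M M₂≈M rowᵣ = begin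
    det m M                                        ≈⟨ det-cong m (λ row c → sym (setRow-sum row c)) ⟩
    det m (setRow r M (λ c → M₁ r c + M₂ r c))     ≈⟨ det-setRow-+ m r M (M₁ r) (M₂ r) ⟩
    det m (setRow r M (M₁ r)) + det m (setRow r M (M₂ r))
      ≈⟨ +-cong (det-cong m (setRow-row M₁ M₁≈M)) (det-cong m (setRow-row M₂ M₂≈M)) ⟩
    det m M₁ + det m M₂                            ∎
    where
    setRow-sum : ∀ row c → setRow r M (λ c → M₁ r c + M₂ r c) row c ≈ M row c
    setRow-sum row c with row == r in row==r
    ... | true rewrite ==⇒≡ row r row==r = sym (rowᵣ c)
    ... | false = refl
    setRow-row : ∀ M′ → (∀ row → (row == r) ≡ false → ∀ c → M′ row c ≈ M row c) →
                 ∀ row c → setRow r M (M′ r) row c ≈ M′ row c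
    setRow-row M′ M′≈M row c with row == r in row==r
    ... | true rewrite ==⇒≡ row r row==r = refl
    ... | false = sym (M′≈M row row==r c)

  setRow-self : ∀ {m} (r : Fin m) (M : Matrix m) → ∀ row c → setRow r M (M r) row c ≈ M row c
  setRow-self r M row c with row == r in row==r
  ... | true rewrite ==⇒≡ row r row==r = refl
  ... | false = refl

  insertZeroAt : ∀ {n} → Fin (suc n) → (Fin n → Carrier) → Fin (suc n) → Carrier
  insertZeroAt j g y with j ≟ y
  ... | yes _   = 0#
  ... | no  j≢y = g (punchOut j≢y)

  sumF-insertZeroAt : ∀ {n} (j : Fin (suc n)) g → sumF (insertZeroAt j g) ≈ sumF g
  sumF-insertZeroAt j g = begin
    sumF (insertZeroAt j g)                                      ≈⟨ sumF-punchIn j (insertZeroAt j g) ⟩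
    insertZeroAt j g j + sumF (insertZeroAt j g ∘ punchIn j)     ≈⟨ +-cong atJ (sumF-cong elsewhere) ⟩
    0# + sumF g                                                  ≈⟨ +-identityˡ _ ⟩
    sumF g                                                       ∎
    where
    atJ : insertZeroAt j g j ≈ 0#
    atJ with j ≟ j
    ... | yes _   = refl
    ... | no  j≢j = ⊥-elim (j≢j ≡.refl)
    elsewhere : ∀ k → insertZeroAt j g (punchIn j k) ≈ g k
    elsewhere k with j ≟ punchIn j k
    ... | yes j≡jₖ = ⊥-elim (punchInᵢ≢i j k (≡.sym j≡jₖ))
    ... | no  j≢jₖ = reflexive (≡.cong g (≡.trans (punchOut-cong j ≡.refl) (punchOut-punchIn j)))

  sign-punchOut : ∀ {n} (j y : Fin (suc n)) (y≢j : y ≢ j) (j≢y : j ≢ y) →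
    sign y * sign (punchOut y≢j) ≈ - (sign j * sign (punchOut j≢y))
  sign-punchOut zero zero y≢j j≢y = ⊥-elim (y≢j ≡.refl)
  sign-punchOut {suc n} zero (suc y) y≢j j≢y = begin
    - sign y * 1#     ≈⟨ *-identityʳ _ ⟩
    - sign y          ≈⟨ -‿cong (*-identityˡ _) ⟨
    - (1# * sign y)   ∎
  sign-punchOut {suc n} (suc j) zero y≢j j≢y = begin
    1# * sign j       ≈⟨ *-identityˡ _ ⟩
    sign j            ≈⟨ -‿involutive _ ⟨
    - (- sign j)      ≈⟨ -‿cong (*-identityʳ _) ⟨
    - (- sign j * 1#) ∎
  sign-punchOut {suc n} (suc j) (suc y) y≢j j≢y = begin
    - sign y * - sign (punchOut (y≢j ∘ ≡.cong suc))       ≈⟨ -x*-y≈x*y _ _ ⟩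
    sign y * sign (punchOut (y≢j ∘ ≡.cong suc))           ≈⟨ sign-punchOut j y (y≢j ∘ ≡.cong suc) (j≢y ∘ ≡.cong suc) ⟩
    - (sign j * sign (punchOut (j≢y ∘ ≡.cong suc)))       ≈⟨ -‿cong (-x*-y≈x*y _ _) ⟨
    - (- sign j * - sign (punchOut (j≢y ∘ ≡.cong suc)))   ∎

  punchIn-punchOut-comm : ∀ {n} (j y : Fin (suc (suc n))) (y≢j : y ≢ j) (j≢y : j ≢ y) (c : Fin n) →
    punchIn y (punchIn (punchOut y≢j) c) ≡ punchIn j (punchIn (punchOut j≢y) c)
  punchIn-punchOut-comm zero    zero    y≢j j≢y c       = ⊥-elim (y≢j ≡.refl)
  punchIn-punchOut-comm zero    (suc y) y≢j j≢y c       = ≡.refl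
  punchIn-punchOut-comm (suc j) zero    y≢j j≢y c       = ≡.refl
  punchIn-punchOut-comm (suc j) (suc y) y≢j j≢y zero    = ≡.refl
  punchIn-punchOut-comm (suc j) (suc y) y≢j j≢y (suc c) =
    ≡.cong suc (punchIn-punchOut-comm j y (y≢j ∘ ≡.cong suc) (j≢y ∘ ≡.cong suc) c)

  -- Expanding along the first two rows, both equal to x, writes det M as a sum of
  -- terms U j y (columns j and y) that is antisymmetric in (j, y).
  module TwoEqualFirstRows {m} (M : Matrix (suc (suc m))) where

    x : Fin (suc (suc m)) → Carrier
    x = M zero

    rest : Fin (suc (suc m)) → Fin (suc m) → Carrier
    rest j k = det m (λ r c → M (suc (suc r)) (punchIn j (punchIn k c)))

    term : Fin (suc (suc m)) → Fin (suc m) → Carrier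
    term j k = (sign j * sign k) * ((x j * x (punchIn j k)) * rest j k)

    U : Fin (suc (suc m)) → Fin (suc (suc m)) → Carrier
    U j = insertZeroAt j (term j)

    U-antisymmetric : ∀ j y → U y j ≈ - U j y
    U-antisymmetric j y with y ≟ j | j ≟ y
    ... | yes _   | yes _   = sym -0#≈0#
    ... | yes y≡j | no  j≢y = ⊥-elim (j≢y (≡.sym y≡j))
    ... | no  y≢j | yes j≡y = ⊥-elim (y≢j (≡.sym j≡y))
    ... | no  y≢j | no  j≢y = begin
      (sign y * sign (punchOut y≢j)) * ((x y * x (punchIn y (punchOut y≢j))) * rest y (punchOut y≢j))
        ≈⟨ *-cong (sign-punchOut j y y≢j j≢y) (*-cong (*-congˡ (reflexive (≡.cong x (punchIn-punchOut y≢j))))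
             (det-cong m (λ r c → reflexive (≡.cong (M (suc (suc r))) (punchIn-punchOut-comm j y y≢j j≢y c))))) ⟩
      (- (sign j * sign (punchOut j≢y))) * ((x y * x j) * rest j (punchOut j≢y))
        ≈⟨ -‿distribˡ-* _ _ ⟨
      - ((sign j * sign (punchOut j≢y)) * ((x y * x j) * rest j (punchOut j≢y)))
        ≈⟨ -‿cong (*-congˡ (*-congʳ (*-comm _ _))) ⟩
      - ((sign j * sign (punchOut j≢y)) * ((x j * x y) * rest j (punchOut j≢y)))
        ≈⟨ -‿cong (*-congˡ (*-congʳ (*-congˡ (reflexive (≡.cong x (punchIn-punchOut j≢y)))))) ⟨
      - ((sign j * sign (punchOut j≢y)) * ((x j * x (punchIn j (punchOut j≢y))) * rest j (punchOut j≢y))) ∎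

    S : Carrier
    S = sumF (λ j → sumF (U j))

    S≈-S : S ≈ - S
    S≈-S = begin
      S                                   ≈⟨ sumF-comm U ⟩
      sumF (λ y → sumF (λ j → U j y))     ≈⟨ sumF-cong (λ y → sumF-cong (λ j → U-antisymmetric y j)) ⟩
      sumF (λ y → sumF (λ j → - U y j))   ≈⟨ sumF-cong (λ y → -‿distrib-sumF (U y)) ⟩
      sumF (λ y → - sumF (U y))           ≈⟨ -‿distrib-sumF (λ y → sumF (U y)) ⟩
      - S                                 ∎

    det≈S : (∀ c → M zero c ≈ M (suc zero) c) → det (suc (suc m)) M ≈ S
    det≈S M₀≈M₁ = begin
      det (suc (suc m)) M
        ≈⟨ altSum≈sumF-sign (λ j → x j * det (suc m) (minor j M)) ⟩
      sumF (λ j → sign j * (x j * det (suc m) (minor j M)))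
        ≈⟨ sumF-cong (λ j → *-congˡ {sign j} (*-congˡ {x j} (altSum≈sumF-sign (λ k → M (suc zero) (punchIn j k) * rest j k)))) ⟩
      sumF (λ j → sign j * (x j * sumF (λ k → sign k * (M (suc zero) (punchIn j k) * rest j k))))
        ≈⟨ sumF-cong (λ j → *-congˡ {sign j} (*-congˡ {x j} (sumF-cong (λ k →
             *-congˡ {sign k} (*-congʳ {rest j k} (sym (M₀≈M₁ (punchIn j k)))))))) ⟩
      sumF (λ j → sign j * (x j * sumF (λ k → sign k * (x (punchIn j k) * rest j k))))
        ≈⟨ sumF-cong (λ j → trans (*-distribˡ-sumF (sign j) (λ k → x j * (sign k * (x (punchIn j k) * rest j k))))
                                     (*-congˡ {sign j} (*-distribˡ-sumF (x j) (λ k → sign k * (x (punchIn j k) * rest j k))))) ⟨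
      sumF (λ j → sumF (λ k → sign j * (x j * (sign k * (x (punchIn j k) * rest j k)))))
        ≈⟨ sumF-cong (λ j → sumF-cong (λ k →
             *-Solver.solve 5 (λ a b c d e → (a ⊛ (b ⊛ (c ⊛ (d ⊛ e)))) ⊜ₘ ((a ⊛ c) ⊛ ((b ⊛ d) ⊛ e))) refl
                   (sign j) (x j) (sign k) (x (punchIn j k)) (rest j k))) ⟩
      sumF (λ j → sumF (term j))
        ≈⟨ sumF-cong (λ j → sumF-insertZeroAt j (term j)) ⟨
      S ∎

  scalarMatrix : ∀ {m} → Carrier → Matrix m
  scalarMatrix a r c = if r == c then a else 0#

  det-scalarMatrix : ∀ m a → det m (scalarMatrix a) ≈ pow a m
  det-scalarMatrix zero    a = refl
  det-scalarMatrix (suc m) a = begin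
    a * det m (scalarMatrix a) + - altSum (λ j → 0# * det m (minor (suc j) (scalarMatrix a)))
      ≈⟨ +-cong (*-congˡ {a} (det-scalarMatrix m a))
                (-‿cong (altSum-zero (λ j → 0# * det m (minor (suc j) (scalarMatrix a))) (λ j → zeroˡ _))) ⟩
    a * pow a m + - 0# ≈⟨ +-congˡ -0#≈0# ⟩
    a * pow a m + 0#   ≈⟨ +-identityʳ _ ⟩
    a * pow a m        ∎

  det-zeroFirstColumn : ∀ m (M : Matrix (suc m)) → (∀ r → M r zero ≈ 0#) → det (suc m) M ≈ 0#
  det-zeroFirstColumn zero M col₀≈0 = begin
    M zero zero * 1# + - 0# ≈⟨ +-cong (*-congʳ (col₀≈0 zero)) -0#≈0# ⟩
    0# * 1# + 0#            ≈⟨ +-identityʳ _ ⟩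
    0# * 1#                 ≈⟨ zeroˡ _ ⟩
    0#                      ∎
  det-zeroFirstColumn (suc m) M col₀≈0 = begin
    M zero zero * det (suc m) (minor zero M) + - altSum (λ j → M zero (suc j) * det (suc m) (minor (suc j) M))
      ≈⟨ +-cong (*-congʳ (col₀≈0 zero)) (-‿cong (altSum-zero _ minors≈0)) ⟩
    0# * det (suc m) (minor zero M) + - 0# ≈⟨ +-cong (zeroˡ _) -0#≈0# ⟩
    0# + 0#                                ≈⟨ +-identityʳ _ ⟩
    0#                                     ∎
    where
    minors≈0 : ∀ j → M zero (suc j) * det (suc m) (minor (suc j) M) ≈ 0#
    minors≈0 j = trans (*-congˡ {M zero (suc j)} (det-zeroFirstColumn m (minor (suc j) M) (λ r → col₀≈0 (suc r))))
                       (zeroʳ _)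

  onesFirstRow : ∀ {m} → Matrix (suc m) → Matrix (suc m)
  onesFirstRow M = setRow zero M (λ _ → 1#)

  det-onesFirstRow-scalarMatrix : ∀ m a → det (suc m) (onesFirstRow (scalarMatrix a)) ≈ pow a m
  det-onesFirstRow-scalarMatrix m a = begin
    1# * det m (scalarMatrix a) + - altSum (λ j → 1# * det m (minor (suc j) (onesFirstRow (scalarMatrix a))))
      ≈⟨ +-cong (*-identityˡ _) (-‿cong (altSum-zero (λ j → 1# * det m (minor (suc j) (onesFirstRow (scalarMatrix a))))
                                                     (λ j → trans (*-identityˡ _) (minor≈0 j)))) ⟩
    det m (scalarMatrix a) + - 0#  ≈⟨ +-cong (det-scalarMatrix m a) -0#≈0# ⟩
    pow a m + 0#                   ≈⟨ +-identityʳ _ ⟩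
    pow a m                        ∎
    where
    minor≈0 : ∀ {m} (j : Fin m) → det m (minor (suc j) (onesFirstRow (scalarMatrix {suc m} a))) ≈ 0#
    minor≈0 {suc m′} j = det-zeroFirstColumn m′ (minor (suc j) (onesFirstRow (scalarMatrix a))) (λ r → refl)

  diagPlusConst : ∀ {m} → Carrier → Carrier → Matrix m
  diagPlusConst a b r c = scalarMatrix a r c + b

  pow-neg : ∀ x m → (pow (- x) m ≈ pow x m) ⊎ (pow (- x) m ≈ - pow x m)
  pow-neg x zero = inj₁ refl
  pow-neg x (suc m) with pow-neg x m
  ... | inj₁ even = inj₂ (trans (*-congˡ { - x} even) (sym (-‿distribˡ-* x (pow x m))))
  ... | inj₂ odd  = inj₁ (trans (*-congˡ { - x} odd) (-x*-y≈x*y x (pow x m)))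

  ZeroDiagonalConstant : ∀ {m} → Matrix m → Carrier → Set ℓ
  ZeroDiagonalConstant H c = ∀ i j → (i ≡ j → H i j ≈ 0#) × (¬ (i ≡ j) → H i j ≈ c)

  module _ (2≉0 : ¬ (fromℕ 2 ≈ 0#)) where

    x≈-x⇒x≈0 : ∀ x → x ≈ - x → x ≈ 0#
    x≈-x⇒x≈0 x x≈-x = x*y≈0⇒y≈0 (fromℕ 2) x 2≉0 (begin
      (1# + (1# + 0#)) * x ≈⟨ *-congʳ (+-congˡ (+-identityʳ 1#)) ⟩
      (1# + 1#) * x        ≈⟨ distribʳ x 1# 1# ⟩
      1# * x + 1# * x      ≈⟨ +-cong (*-identityˡ x) (*-identityˡ x) ⟩
      x + x                ≈⟨ +-congˡ x≈-x ⟩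
      x + - x              ≈⟨ -‿inverseʳ x ⟩
      0#                   ∎)

    det-twoEqualFirstRows : ∀ {m} (M : Matrix (suc (suc m))) → (∀ c → M zero c ≈ M (suc zero) c) →
      det (suc (suc m)) M ≈ 0#
    det-twoEqualFirstRows {m} M M₀≈M₁ = x≈-x⇒x≈0 (det (suc (suc m)) M)
      (trans (det≈S M₀≈M₁) (trans S≈-S (-‿cong (sym (det≈S M₀≈M₁)))))
      where open TwoEqualFirstRows M

    det-equalAdjacentRows : ∀ m (M : Matrix (suc m)) (r : Fin m) → (∀ c → M (inject₁ r) c ≈ M (suc r) c) →
      det (suc m) M ≈ 0#
    det-equalAdjacentRows (suc m) M zero    Mᵣ≈Mᵣ₊₁ = det-twoEqualFirstRows M Mᵣ≈Mᵣ₊₁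
    det-equalAdjacentRows (suc m) M (suc r) Mᵣ≈Mᵣ₊₁ = altSum-zero _ (λ j →
      trans (*-congˡ {M zero j} (det-equalAdjacentRows m (minor j M) r (λ c → Mᵣ≈Mᵣ₊₁ (punchIn j c)))) (zeroʳ (M zero j)))

    module AdjacentRows {m} (M : Matrix (suc m)) (r : Fin m) where

      withRows : (u w : Fin (suc m) → Carrier) → Matrix (suc m)
      withRows u w row c = if row == inject₁ r then u c else (if row == suc r then w c else M row c)

      withRows-first : ∀ u w c → withRows u w (inject₁ r) c ≈ u c
      withRows-first u w c rewrite ==-refl (inject₁ r) = refl

      withRows-second : ∀ u w c → withRows u w (suc r) c ≈ w c
      withRows-second u w c rewrite suc==inject₁ r | ==-refl (suc r) = refl

      withRows-M : ∀ row c → M row c ≈ withRows (M (inject₁ r)) (M (suc r)) row c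
      withRows-M row c with row == inject₁ r in row==p
      ... | true rewrite ==⇒≡ row (inject₁ r) row==p = refl
      ... | false with row == suc r in row==q
      ...   | true rewrite ==⇒≡ row (suc r) row==q = refl
      ...   | false = refl

      det-withRows-same : ∀ s → det (suc m) (withRows s s) ≈ 0#
      det-withRows-same s = det-equalAdjacentRows m (withRows s s) r
        (λ c → trans (withRows-first s s c) (sym (withRows-second s s c)))

      det-withRows-+ˡ : ∀ w x y →
        det (suc m) (withRows (λ c → x c + y c) w) ≈ det (suc m) (withRows x w) + det (suc m) (withRows y w)
      det-withRows-+ˡ w x y = det-additive (suc m) (inject₁ r) _ _ _ (others x) (others y)
        (λ c → trans (withRows-first (λ c → x c + y c) w c) (sym (+-cong (withRows-first x w c) (withRows-first y w c))))
        where
        others : ∀ z row → (row == inject₁ r) ≡ false → ∀ c → withRows z w row c ≈ withRows (λ c → x c + y c) w row c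
        others z row row≢p c rewrite row≢p = refl

      det-withRows-+ʳ : ∀ u x y →
        det (suc m) (withRows u (λ c → x c + y c)) ≈ det (suc m) (withRows u x) + det (suc m) (withRows u y)
      det-withRows-+ʳ u x y = det-additive (suc m) (suc r) _ _ _ (others x) (others y)
        (λ c → trans (withRows-second u (λ c → x c + y c) c) (sym (+-cong (withRows-second u x c) (withRows-second u y c))))
        where
        others : ∀ z row → (row == suc r) ≡ false → ∀ c → withRows u z row c ≈ withRows u (λ c → x c + y c) row c
        others z row row≢q c with row == inject₁ r
        ... | true  = refl
        ... | false rewrite row≢q = refl

      -- 0 = D(x+y, x+y) = D(x, x) + D(x, y) + D(y, x) + D(y, y) = D(x, y) + D(y, x)
      det-withRows-swap : ∀ x y → det (suc m) (withRows y x) ≈ - det (suc m) (withRows x y)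
      det-withRows-swap x y = begin
        B               ≈⟨ +-identityʳ B ⟨
        B + 0#          ≈⟨ +-congˡ (-‿inverseʳ A) ⟨
        B + (A + - A)   ≈⟨ +-assoc B A (- A) ⟨
        (B + A) + - A   ≈⟨ +-congʳ B+A≈0 ⟩
        0# + - A        ≈⟨ +-identityˡ (- A) ⟩
        - A             ∎
        where
        s = λ c → x c + y c
        A = det (suc m) (withRows x y)
        B = det (suc m) (withRows y x)
        B+A≈0 : B + A ≈ 0#
        B+A≈0 = begin
          B + A                 ≈⟨ +-cong (+-identityˡ B) (+-identityʳ A) ⟨
          (0# + B) + (A + 0#)   ≈⟨ +-cong (+-congʳ (det-withRows-same x)) (+-congˡ (det-withRows-same y)) ⟨
          (det (suc m) (withRows x x) + B) + (A + det (suc m) (withRows y y))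
            ≈⟨ +-cong (det-withRows-+ˡ x x y) (det-withRows-+ˡ y x y) ⟨
          det (suc m) (withRows s x) + det (suc m) (withRows s y) ≈⟨ det-withRows-+ʳ s x y ⟨
          det (suc m) (withRows s s) ≈⟨ det-withRows-same s ⟩
          0#                         ∎

    -- Swapping rows r and r + 1 moves the copy of row 0 one step up, down to the adjacent case.
    det-firstRowRepeated : ∀ m (M : Matrix (suc m)) (r : Fin m) → (∀ c → M zero c ≈ M (suc r) c) →
      det (suc m) M ≈ 0#
    det-firstRowRepeated m M r = go (toℕ r) m M r ≡.refl
      where
      go : ∀ k m (M : Matrix (suc m)) (r : Fin m) → toℕ r ≡ k → (∀ c → M zero c ≈ M (suc r) c) → det (suc m) M ≈ 0#
      go k m M zero _ M₀≈Mᵣ = det-equalAdjacentRows m M zero M₀≈Mᵣ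
      go (suc k) (suc m) M (suc r) r≡k M₀≈Mᵣ = begin
        det (suc (suc m)) M                             ≈⟨ det-cong (suc (suc m)) withRows-M ⟩
        det (suc (suc m)) (withRows x y)                ≈⟨ -‿involutive _ ⟨
        - (- det (suc (suc m)) (withRows x y))          ≈⟨ -‿cong (det-withRows-swap x y) ⟨
        - det (suc (suc m)) (withRows y x)              ≈⟨ -‿cong swapped≈0 ⟩
        - 0#                                            ≈⟨ -0#≈0# ⟩
        0#                                              ∎
        where
        open AdjacentRows M (suc r)
        x = M (suc (inject₁ r))
        y = M (suc (suc r))
        swapped≈0 : det (suc (suc m)) (withRows y x) ≈ 0#
        swapped≈0 = go k (suc m) (withRows y x) (inject₁ r) (≡.trans (toℕ-inject₁ r) (≡.cong ℕ.pred r≡k))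
                      (λ c → trans (M₀≈Mᵣ c) (sym (withRows-first y x c)))

    det-addFirstRow : ∀ m (M : Matrix (suc m)) (r : Fin m) (t : Carrier) →
      det (suc m) (setRow (suc r) M (λ c → M (suc r) c + t * M zero c)) ≈ det (suc m) M
    det-addFirstRow m M r t = begin
      det (suc m) (setRow (suc r) M (λ c → M (suc r) c + t * M zero c))
        ≈⟨ det-setRow-+ (suc m) (suc r) M (M (suc r)) (λ c → t * M zero c) ⟩
      det (suc m) (setRow (suc r) M (M (suc r))) + det (suc m) (setRow (suc r) M (λ c → t * M zero c))
        ≈⟨ +-cong (det-cong (suc m) (setRow-self (suc r) M)) (det-setRow-* (suc m) (suc r) M t (M zero)) ⟩
      det (suc m) M + t * det (suc m) (setRow (suc r) M (M zero))
        ≈⟨ +-congˡ (*-congˡ {t} (det-firstRowRepeated m (setRow (suc r) M (M zero)) r repeated)) ⟩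
      det (suc m) M + t * 0#  ≈⟨ +-congˡ (zeroʳ t) ⟩
      det (suc m) M + 0#      ≈⟨ +-identityʳ _ ⟩
      det (suc m) M           ∎
      where
      repeated : ∀ c → setRow (suc r) M (M zero) zero c ≈ setRow (suc r) M (M zero) (suc r) c
      repeated c rewrite ==-refl r = refl

    addFirstRowTo : ∀ {m} → Carrier → List (Fin m) → Matrix (suc m) → Matrix (suc m)
    addFirstRowTo t []       M = M
    addFirstRowTo t (r ∷ rs) M = setRow (suc r) N (λ c → N (suc r) c + t * N zero c)
      where N = addFirstRowTo t rs M

    det-addFirstRowTo : ∀ {m} t (rs : List (Fin m)) M → det (suc m) (addFirstRowTo t rs M) ≈ det (suc m) M
    det-addFirstRowTo     t []       M = refl
    det-addFirstRowTo {m} t (r ∷ rs) M = trans (det-addFirstRow m (addFirstRowTo t rs M) r t) (det-addFirstRowTo t rs M)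

    occurrences : ∀ {m} → Fin m → List (Fin m) → ℕ
    occurrences r []        = 0
    occurrences r (r′ ∷ rs) = (if r == r′ then 1 else 0) ℕ.+ occurrences r rs

    addFirstRowTo-zero : ∀ {m} t (rs : List (Fin m)) M c → addFirstRowTo t rs M zero c ≈ M zero c
    addFirstRowTo-zero t []       M c = refl
    addFirstRowTo-zero t (r ∷ rs) M c = addFirstRowTo-zero t rs M c

    addFirstRowTo-suc : ∀ {m} t (rs : List (Fin m)) M r c →
      addFirstRowTo t rs M (suc r) c ≈ M (suc r) c + fromℕ (occurrences r rs) * (t * M zero c)
    addFirstRowTo-suc t []        M r c = sym (trans (+-congˡ (zeroˡ _)) (+-identityʳ _))
    addFirstRowTo-suc t (r′ ∷ rs) M r c with r == r′ in r==r′
    ... | false = addFirstRowTo-suc t rs M r c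
    ... | true with ≡.refl ← ==⇒≡ r r′ r==r′ = begin
      addFirstRowTo t rs M (suc r) c + t * addFirstRowTo t rs M zero c
        ≈⟨ +-cong (addFirstRowTo-suc t rs M r c) (*-congˡ {t} (addFirstRowTo-zero t rs M c)) ⟩
      (A + F * B) + B      ≈⟨ solve 3 (λ a f b → ((a ⊕ f ⊗ b) ⊕ b) ⊜ (a ⊕ (b ⊕ f ⊗ b))) refl A F B ⟩
      A + (B + F * B)      ≈⟨ +-congˡ (+-congʳ (*-identityˡ B)) ⟨
      A + (1# * B + F * B) ≈⟨ +-congˡ (distribʳ B 1# F) ⟨
      A + (1# + F) * B     ∎
      where
      A = M (suc r) c
      F = fromℕ (occurrences r rs)
      B = t * M zero c

    allRows : (m : ℕ) → List (Fin m)
    allRows zero    = []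
    allRows (suc m) = zero ∷ map suc (allRows m)

    occurrences-zero-map-suc : ∀ {m} (l : List (Fin m)) → occurrences zero (map suc l) ≡ 0
    occurrences-zero-map-suc []      = ≡.refl
    occurrences-zero-map-suc (x ∷ l) = occurrences-zero-map-suc l

    occurrences-suc-map-suc : ∀ {m} (r : Fin m) (l : List (Fin m)) → occurrences (suc r) (map suc l) ≡ occurrences r l
    occurrences-suc-map-suc r []      = ≡.refl
    occurrences-suc-map-suc r (x ∷ l) = ≡.cong ((if r == x then 1 else 0) ℕ.+_) (occurrences-suc-map-suc r l)

    occurrences-allRows : ∀ {m} (r : Fin m) → occurrences r (allRows m) ≡ 1
    occurrences-allRows {suc m} zero    = ≡.cong suc (occurrences-zero-map-suc (allRows m))
    occurrences-allRows {suc m} (suc r) = ≡.trans (occurrences-suc-map-suc r (allRows m)) (occurrences-allRows r)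

    det-onesFirstRow-diagPlusConst : ∀ m a b → det (suc m) (onesFirstRow (diagPlusConst a b)) ≈ pow a m
    det-onesFirstRow-diagPlusConst m a b = begin
      det (suc m) Q                                      ≈⟨ det-addFirstRowTo (- b) (allRows m) Q ⟨
      det (suc m) (addFirstRowTo (- b) (allRows m) Q)    ≈⟨ det-cong (suc m) subtracted ⟩
      det (suc m) (onesFirstRow (scalarMatrix a))        ≈⟨ det-onesFirstRow-scalarMatrix m a ⟩
      pow a m                                            ∎
      where
      Q = onesFirstRow (diagPlusConst a b)
      subtracted : ∀ row c → addFirstRowTo (- b) (allRows m) Q row c ≈ onesFirstRow (scalarMatrix a) row c
      subtracted zero    c = addFirstRowTo-zero (- b) (allRows m) Q c
      subtracted (suc r) c = begin
        addFirstRowTo (- b) (allRows m) Q (suc r) c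
          ≈⟨ addFirstRowTo-suc (- b) (allRows m) Q r c ⟩
        (E + b) + fromℕ (occurrences r (allRows m)) * (- b * 1#)
          ≈⟨ +-congˡ (*-congʳ (reflexive (≡.cong fromℕ (occurrences-allRows r)))) ⟩
        (E + b) + (1# + 0#) * (- b * 1#)  ≈⟨ +-congˡ (*-cong (+-identityʳ 1#) (*-identityʳ (- b))) ⟩
        (E + b) + 1# * - b                ≈⟨ +-congˡ (*-identityˡ (- b)) ⟩
        (E + b) + - b                     ≈⟨ +-assoc E b (- b) ⟩
        E + (b + - b)                     ≈⟨ +-congˡ (-‿inverseʳ b) ⟩
        E + 0#                            ≈⟨ +-identityʳ E ⟩
        E                                 ∎
        where E = scalarMatrix a (suc r) c

    det-diagPlusConst-suc : ∀ m a b → det (suc m) (diagPlusConst a b) ≈ a * det m (diagPlusConst a b) + b * pow a m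
    det-diagPlusConst-suc m a b = begin
      altSum (λ j → (scalarMatrix a zero j + b) * D j)
        ≈⟨ altSum-cong (λ j → distribʳ (D j) (scalarMatrix a zero j) b) ⟩
      altSum (λ j → scalarMatrix a zero j * D j + b * D j)
        ≈⟨ altSum-+ (λ j → scalarMatrix a zero j * D j) (λ j → b * D j) ⟩
      (a * D zero + - altSum (λ j → 0# * D (suc j))) + altSum (λ j → b * D j)
        ≈⟨ +-cong (+-congˡ (-‿cong (altSum-zero (λ j → 0# * D (suc j)) (λ j → zeroˡ _)))) (*-distribˡ-altSum b D) ⟩
      (a * D zero + - 0#) + b * altSum D
        ≈⟨ +-cong (trans (+-congˡ -0#≈0#) (+-identityʳ _)) (*-congˡ {b} (altSum-cong (λ j → sym (*-identityˡ (D j))))) ⟩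
      a * det m (diagPlusConst a b) + b * det (suc m) (onesFirstRow (diagPlusConst a b))
        ≈⟨ +-congˡ (*-congˡ {b} (det-onesFirstRow-diagPlusConst m a b)) ⟩
      a * det m (diagPlusConst a b) + b * pow a m ∎
      where
      D : Fin (suc m) → Carrier
      D j = det m (minor j (diagPlusConst a b))

    det-diagPlusConst : ∀ m a b → det (suc m) (diagPlusConst a b) ≈ pow a m * (a + fromℕ (suc m) * b)
    det-diagPlusConst zero a b = begin
      det 1 (diagPlusConst a b)  ≈⟨ det-diagPlusConst-suc zero a b ⟩
      a * 1# + b * 1#            ≈⟨ distribʳ 1# a b ⟨
      (a + b) * 1#               ≈⟨ *-comm _ _ ⟩
      1# * (a + b)               ≈⟨ *-congˡ {1#} (+-congˡ (*-identityˡ b)) ⟨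
      1# * (a + 1# * b)          ≈⟨ *-congˡ {1#} (+-congˡ (*-congʳ (+-identityʳ 1#))) ⟨
      1# * (a + (1# + 0#) * b)   ∎
    det-diagPlusConst (suc m) a b = begin
      det (suc (suc m)) (diagPlusConst a b)           ≈⟨ det-diagPlusConst-suc (suc m) a b ⟩
      a * det (suc m) (diagPlusConst a b) + b * pow a (suc m) ≈⟨ +-congʳ (*-congˡ {a} (det-diagPlusConst m a b)) ⟩
      a * (p * (a + f * b)) + b * (a * p)             ≈⟨ +-cong (sym (*-assoc a p _)) (*-comm b (a * p)) ⟩
      (a * p) * (a + f * b) + (a * p) * b             ≈⟨ distribˡ (a * p) _ b ⟨
      (a * p) * ((a + f * b) + b)
        ≈⟨ *-congˡ {a * p} (solve 3 (λ a b f → ((a ⊕ f ⊗ b) ⊕ b) ⊜ (a ⊕ (b ⊕ f ⊗ b))) refl a b f) ⟩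
      (a * p) * (a + (b + f * b))                     ≈⟨ *-congˡ {a * p} (+-congˡ (+-congʳ (*-identityˡ b))) ⟨
      (a * p) * (a + (1# * b + f * b))                ≈⟨ *-congˡ {a * p} (+-congˡ (distribʳ b 1# f)) ⟨
      (a * p) * (a + (1# + f) * b)                    ∎
      where
      p = pow a m
      f = fromℕ (suc m)

    det-zeroDiagonalConstant : ∀ m (H : Matrix (suc m)) c → ZeroDiagonalConstant H c →
      det (suc m) H ≈ pow (- c) m * (fromℕ m * c)
    det-zeroDiagonalConstant m H c H-shape = begin
      det (suc m) H                                   ≈⟨ det-cong (suc m) H≈c[J-I] ⟩
      det (suc m) (diagPlusConst (- c) c)             ≈⟨ det-diagPlusConst m (- c) c ⟩
      pow (- c) m * (- c + (1# + fromℕ m) * c)        ≈⟨ *-congˡ {pow (- c) m} (lemma c (fromℕ m)) ⟩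
      pow (- c) m * (fromℕ m * c)                     ∎
      where
      H≈c[J-I] : ∀ i j → H i j ≈ diagPlusConst (- c) c i j
      H≈c[J-I] i j with i == j in i==j
      ... | true  = trans (proj₁ (H-shape i j) (==⇒≡ i j i==j)) (sym (-‿inverseˡ c))
      ... | false = trans (proj₂ (H-shape i j) (==-false⇒≢ i j i==j)) (sym (+-identityˡ c))
      lemma : ∀ c f → - c + (1# + f) * c ≈ f * c
      lemma c f = begin
        - c + (1# + f) * c       ≈⟨ +-congˡ (trans (distribʳ c 1# f) (+-congʳ (*-identityˡ c))) ⟩
        - c + (c + f * c)        ≈⟨ +-assoc (- c) c _ ⟨
        (- c + c) + f * c        ≈⟨ +-congʳ (-‿inverseˡ c) ⟩
        0# + f * c               ≈⟨ +-identityˡ _ ⟩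
        f * c                    ∎

    det-zeroDiagonalConstant-± : ∀ N (H : Matrix N) c → 1 ℕ.≤ N → ZeroDiagonalConstant H c →
      (det N H ≈ fromℕ (N ℕ.∸ 1) * pow c N) ⊎ (det N H ≈ - (fromℕ (N ℕ.∸ 1) * pow c N))
    det-zeroDiagonalConstant-± (suc m) H c _ H-shape = Sum.map even odd (pow-neg c m)
      where
      D = det (suc m) H
      rearrange : ∀ p f c → p * (f * c) ≈ f * (c * p)
      rearrange = solve 3 (λ p f c → (p ⊗ (f ⊗ c)) ⊜ (f ⊗ (c ⊗ p))) refl
      even : pow (- c) m ≈ pow c m → D ≈ fromℕ m * pow c (suc m)
      even [-c]ᵐ≈cᵐ = begin
        D                             ≈⟨ det-zeroDiagonalConstant m H c H-shape ⟩
        pow (- c) m * (fromℕ m * c)   ≈⟨ *-congʳ [-c]ᵐ≈cᵐ ⟩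
        pow c m * (fromℕ m * c)       ≈⟨ rearrange (pow c m) (fromℕ m) c ⟩
        fromℕ m * pow c (suc m)       ∎
      odd : pow (- c) m ≈ - pow c m → D ≈ - (fromℕ m * pow c (suc m))
      odd [-c]ᵐ≈-cᵐ = begin
        D                             ≈⟨ det-zeroDiagonalConstant m H c H-shape ⟩
        pow (- c) m * (fromℕ m * c)   ≈⟨ *-congʳ [-c]ᵐ≈-cᵐ ⟩
        - pow c m * (fromℕ m * c)     ≈⟨ -‿distribˡ-* _ _ ⟨
        - (pow c m * (fromℕ m * c))   ≈⟨ -‿cong (rearrange (pow c m) (fromℕ m) c) ⟩
        - (fromℕ m * pow c (suc m))   ∎

module LinearAlgebra {a ℓ q} (𝔽 : FiniteField a ℓ q) where

  open import Defs
  open import Level using (_⊔_)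
  open import Data.Nat using (ℕ; zero; suc; _≤_; _^_)
  import Data.Nat as ℕ
  import Data.Nat.Properties as ℕ
  open import Data.Fin using (Fin; zero; suc; finToFun; funToFin; combine)
  open import Data.Fin.Properties using (finToFun-funToFin; funToFin-finToFin; any?; all?)
    renaming (_≟_ to _≟ᶠ_)
  open import Data.Bool using (Bool; true; false; if_then_else_; _∨_)
  open import Data.Vec using (Vec; []; _∷_; lookup)
  import Data.Vec as Vec
  open import Data.Product using (_×_; _,_; proj₁; proj₂; ∃)
  open import Data.Empty using (⊥-elim)
  open import Function using (_∘_)
  open import Relation.Nullary using (yes; no; ¬_; Dec)
  open import Relation.Nullary.Decidable using (⌊_⌋; _×-dec_; _→-dec_)
  import Relation.Binary.PropositionalEquality as ≡
  open ≡ using (_≡_; _≢_)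

  open Counting
  open Subsets
  open IncreasingTuples

  open FiniteField 𝔽
  open LinAlg 𝔽 hiding (sumF-cong)
  open FieldFacts field′
  open import Relation.Binary.Reasoning.Setoid setoid

  index-cong : ∀ {x y} → x ≈ y → index x ≡ index y
  index-cong {x} {y} x≈y = enum-inj (index x) (index y) (trans (enum-index x) (trans x≈y (sym (enum-index y))))

  index-enum : ∀ i → index (enum i) ≡ i
  index-enum i = enum-inj _ _ (enum-index (enum i))

  zeroIndex : Fin q
  zeroIndex = index 0#

  enum≈0⇒≡zeroIndex : ∀ i → enum i ≈ 0# → i ≡ zeroIndex
  enum≈0⇒≡zeroIndex i e = ≡.trans (≡.sym (index-enum i)) (index-cong e)

  enum-zeroIndex : enum zeroIndex ≈ 0#
  enum-zeroIndex = enum-index 0#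

  decode : ∀ {m} → Fin (q ^ m) → Vector m
  decode {m} x k = enum (finToFun {q} {m} x k)

  encode : ∀ {m} → Vector m → Fin (q ^ m)
  encode {m} u = funToFin {m} {q} (index ∘ u)

  funToFin-cong : ∀ {m k} {f g : Fin m → Fin k} → (∀ i → f i ≡ g i) → funToFin f ≡ funToFin g
  funToFin-cong {zero}  f≡g = ≡.refl
  funToFin-cong {suc m} f≡g = ≡.cong₂ combine (f≡g zero) (funToFin-cong (f≡g ∘ suc))

  encode-cong : ∀ {m} {u w : Vector m} → u ≋ w → encode u ≡ encode w
  encode-cong u≋w = funToFin-cong (λ k → index-cong (u≋w k))

  decode-encode : ∀ {m} (u : Vector m) → decode (encode u) ≋ u
  decode-encode {m} u k = trans (reflexive (≡.cong enum (finToFun-funToFin {m} {q} (index ∘ u) k))) (enum-index (u k))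

  encode-decode : ∀ {m} (x : Fin (q ^ m)) → encode {m} (decode {m} x) ≡ x
  encode-decode {m} x = ≡.trans (funToFin-cong (λ k → index-enum (finToFun {q} {m} x k))) (funToFin-finToFin {m} {q} x)

  encode-injective : ∀ {m} {u w : Vector m} → encode u ≡ encode w → u ≋ w
  encode-injective {m} {u} {w} e k =
    trans (sym (decode-encode u k)) (trans (reflexive (≡.cong (λ c → decode {m} c k) e)) (decode-encode w k))

  decode-injective : ∀ {m} {x y : Fin (q ^ m)} → decode {m} x ≋ decode {m} y → x ≡ y
  decode-injective {m} {x} {y} e = ≡.trans (≡.sym (encode-decode {m} x)) (≡.trans (encode-cong e) (encode-decode {m} y))

  ·-cancelʳ : ∀ {m} (x y : Carrier) (w : Vector m) → (x · w) ≋ (y · w) → ¬ (w ≋ 0V) → x ≈ y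
  ·-cancelʳ x y w xw≋yw w≉0 with x ≟ y
  ... | yes x≈y = x≈y
  ... | no  x≉y = ⊥-elim (w≉0 λ k → x*y≈0⇒y≈0 (x + - y) (w k) (λ x-y≈0 → x≉y (x∙y⁻¹≈ε⇒x≈y x y x-y≈0)) (begin
      (x + - y) * w k       ≈⟨ distribʳ (w k) x (- y) ⟩
      x * w k + - y * w k   ≈⟨ +-congˡ (-‿distribˡ-* y (w k)) ⟨
      x * w k + - (y * w k) ≈⟨ +-congˡ (-‿cong (xw≋yw k)) ⟨
      x * w k + - (x * w k) ≈⟨ -‿inverseʳ _ ⟩
      0#                    ∎))

  lincomb-zero : ∀ {n m} (c : Fin m → Carrier) (w : Fin m → Vector n) → (∀ j → c j ≈ 0#) → lincomb c w ≋ 0V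
  lincomb-zero {n} {m} c w c≈0 k = trans (sumF-cong (λ j → trans (*-congʳ (c≈0 j)) (zeroˡ _))) (sumF-zero {m})

  lincomb-* : ∀ {n m} (t : Carrier) (c : Fin m → Carrier) (w : Fin m → Vector n) →
    lincomb (λ j → t * c j) w ≋ (t · lincomb c w)
  lincomb-* t c w k = begin
    sumF (λ j → (t * c j) * w j k)  ≈⟨ sumF-cong (λ j → *-assoc t (c j) (w j k)) ⟩
    sumF (λ j → t * (c j * w j k))  ≈⟨ *-distribˡ-sumF t (λ j → c j * w j k) ⟩
    t * sumF (λ j → c j * w j k)    ∎

  lincomb-difference : ∀ {n m} (c d : Fin m → Carrier) (w : Fin m → Vector n) →
    lincomb c w ≋ lincomb d w → lincomb (λ j → c j + - d j) w ≋ 0V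
  lincomb-difference c d w c≋d k = begin
    sumF (λ j → (c j + - d j) * w j k)                 ≈⟨ sumF-cong (λ j → distribʳ (w j k) (c j) (- d j)) ⟩
    sumF (λ j → c j * w j k + - d j * w j k)           ≈⟨ sumF-+ (λ j → c j * w j k) (λ j → - d j * w j k) ⟩
    lincomb c w k + sumF (λ j → - d j * w j k)         ≈⟨ +-congˡ (sumF-cong (λ j → -‿distribˡ-* (d j) (w j k))) ⟨
    lincomb c w k + sumF (λ j → - (d j * w j k))       ≈⟨ +-congˡ (-‿distrib-sumF (λ j → d j * w j k)) ⟩
    lincomb c w k + - lincomb d w k                    ≈⟨ +-congˡ (-‿cong (c≋d k)) ⟨
    lincomb c w k + - lincomb c w k                    ≈⟨ -‿inverseʳ (lincomb c w k) ⟩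
    0#                                                 ∎

  -- The coefficient map c ↦ Σ c_j w_j is injective on the finite set 𝔽^n, hence onto.
  LinIndep⇒Spans : ∀ {n} (w : Fin n → Vector n) → LinIndep w → Spans w
  LinIndep⇒Spans {n} w indep u = decode x , encode-injective φx≡u
    where
    φ : Fin (q ^ n) → Fin (q ^ n)
    φ x = encode (lincomb (decode x) w)
    φ-injective : InjectiveOn (λ _ → true) (λ _ → true) φ
    φ-injective x y _ _ φx≡φy = decode-injective (λ i →
      x∙y⁻¹≈ε⇒x≈y _ _ (indep (λ i → decode x i + - decode y i) (lincomb-difference _ _ w (encode-injective φx≡φy)) i))
    inImage : Fin (q ^ n) → Bool
    inImage y = ⌊ any? (λ x → φ x ≟ᶠ y) ⌋
    all≤image : q ^ n ≤ count inImage
    all≤image = ℕ.≤-trans (ℕ.≤-reflexive (≡.sym (≡.trans (sum-const {q ^ n} 1) (ℕ.*-identityʳ _))))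
      (count-injection (λ _ → true) inImage φ (λ x _ → ⌊⌋-yes (any? (λ x′ → φ x′ ≟ᶠ φ x)) (x , ≡.refl)) φ-injective)
    onto : ∃ λ x → φ x ≡ encode u
    onto = ⌊⌋-yes⁻¹ (any? (λ x → φ x ≟ᶠ encode u))
             (count≡size⇒true inImage (ℕ.≤-antisym (count≤ inImage) all≤image) (encode u))
    x = proj₁ onto
    φx≡u : encode (lincomb (decode x) w) ≡ encode u
    φx≡u = proj₂ onto

  ·-inverse : ∀ {m} (t : Carrier) (t≉0 : ¬ (t ≈ 0#)) {u w : Vector m} → u ≋ (t · w) → w ≋ (inv t t≉0 · u)
  ·-inverse t t≉0 {u} {w} u≋tw k = begin
    w k                       ≈⟨ *-identityˡ _ ⟨
    1# * w k                  ≈⟨ *-congʳ (trans (*-comm _ _) (inv-cancel t t≉0)) ⟨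
    (inv t t≉0 * t) * w k     ≈⟨ *-assoc _ _ _ ⟩
    inv t t≉0 * (t * w k)     ≈⟨ *-congˡ {inv t t≉0} (u≋tw k) ⟨
    inv t t≉0 * u k           ∎

  sumF-Increasing : ∀ {k N t} → Increasing k N t → (h : Fin N → Carrier) →
    (∀ i → lookup (toSubset t) i ≡ false → h i ≈ 0#) → sumF h ≈ sumF (h ∘ lookup t)
  sumF-Increasing {N = zero}  nil h _   = refl
  sumF-Increasing {N = suc N} nil h h≈0 = trans (sumF-cong (λ i → h≈0 i (lookup-∅ i))) (sumF-zero {suc N})
  sumF-Increasing (take {t = t} I) h h≈0 = +-congˡ (begin
    sumF (h ∘ suc)
      ≈⟨ sumF-Increasing I (h ∘ suc) (λ i i∉t → h≈0 (suc i)
           (≡.subst (λ s → lookup s (suc i) ≡ false) (≡.sym (≡.cong (insert zero) (toSubset-map-suc t))) i∉t)) ⟩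
    sumF (λ m → h (suc (lookup t m))) ≈⟨ sumF-cong (λ m → reflexive (≡.cong h (≡.sym (lookup-map-suc t m)))) ⟩
    sumF (λ m → h (lookup (Vec.map suc t) m)) ∎)
  sumF-Increasing (skip {t = t} I) h h≈0 = begin
    h zero + sumF (h ∘ suc)
      ≈⟨ +-cong (h≈0 zero (≡.cong (λ s → lookup s zero) (toSubset-map-suc t)))
                (sumF-Increasing I (h ∘ suc) (λ i i∉t →
                   h≈0 (suc i) (≡.trans (≡.cong (λ s → lookup s (suc i)) (toSubset-map-suc t)) i∉t))) ⟩
    0# + sumF (λ m → h (suc (lookup t m))) ≈⟨ +-identityˡ _ ⟩
    sumF (λ m → h (suc (lookup t m)))      ≈⟨ sumF-cong (λ m → reflexive (≡.cong h (≡.sym (lookup-map-suc t m)))) ⟩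
    sumF (λ m → h (lookup (Vec.map suc t) m)) ∎

  spread : ∀ {k N t} → Increasing k N t → (Fin k → Carrier) → Fin N → Carrier
  spread nil      c i       = 0#
  spread (take I) c zero    = c zero
  spread (take I) c (suc i) = spread I (c ∘ suc) i
  spread (skip I) c zero    = 0#
  spread (skip I) c (suc i) = spread I c i

  spread-lookup : ∀ {k N t} (I : Increasing k N t) c m → spread I c (lookup t m) ≡ c m
  spread-lookup (take I) c zero = ≡.refl
  spread-lookup (take {t = t} I) c (suc m) rewrite lookup-map-suc t m = spread-lookup I (c ∘ suc) m
  spread-lookup (skip {t = t} I) c m rewrite lookup-map-suc t m = spread-lookup I c m

  spread-outside : ∀ {k N t} (I : Increasing k N t) c i → lookup (toSubset t) i ≡ false → spread I c i ≈ 0#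
  spread-outside nil c i _ = refl
  spread-outside (take {t = t} I) c zero i∉t rewrite toSubset-map-suc t with () ← i∉t
  spread-outside (take {t = t} I) c (suc i) i∉t rewrite toSubset-map-suc t = spread-outside I (c ∘ suc) i i∉t
  spread-outside (skip I) c zero _ = refl
  spread-outside (skip {t = t} I) c (suc i) i∉t rewrite toSubset-map-suc t = spread-outside I c i i∉t

  module Family {n N : ℕ} (v : Fin N → Vector n) where

    SupportedIn : Subset N → (Fin N → Carrier) → Set ℓ
    SupportedIn A c = ∀ i → lookup A i ≡ false → c i ≈ 0#

    SupportedIn? : ∀ A c → Dec (SupportedIn A c)
    SupportedIn? A c = all? (λ i → vanishes? i (lookup A i))
      where
      vanishes? : ∀ i b → Dec (b ≡ false → c i ≈ 0#)
      vanishes? i true  = yes (λ ())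
      vanishes? i false with c i ≟ 0#
      ... | yes cᵢ≈0 = yes (λ _ → cᵢ≈0)
      ... | no  cᵢ≉0 = no (λ h → cᵢ≉0 (h ≡.refl))

    Independent : Subset N → Set (a ⊔ ℓ)
    Independent A = ∀ c → SupportedIn A c → lincomb c v ≋ 0V → ∀ i → c i ≈ 0#

    InSpan : Subset N → Vector n → Set (a ⊔ ℓ)
    InSpan A u = ∃ λ c → SupportedIn A c × (lincomb c v ≋ u)

    Independent? : ∀ A → Dec (Independent A)
    Independent? A = ∀fun? N _ resp (λ c → SupportedIn? A c →-dec (≋? (lincomb c v) 0V →-dec all? (λ i → c i ≟ 0#)))
      where
      resp : Resp (λ c → SupportedIn A c → lincomb c v ≋ 0V → ∀ i → c i ≈ 0#)
      resp f≈g h supp lc≈0 i = trans (sym (f≈g i))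
        (h (λ j j∉A → trans (f≈g j) (supp j j∉A)) (λ k → trans (lincomb-cong v f≈g k) (lc≈0 k)) i)

    InSpan? : ∀ A u → Dec (InSpan A u)
    InSpan? A u = ∃fun? N _ resp (λ c → SupportedIn? A c ×-dec ≋? (lincomb c v) u)
      where
      resp : Resp (λ c → SupportedIn A c × (lincomb c v ≋ u))
      resp f≈g (supp , lc≈u) = (λ j j∉A → trans (sym (f≈g j)) (supp j j∉A)) ,
                               (λ k → trans (sym (lincomb-cong v f≈g k)) (lc≈u k))

    isIndependent : Subset N → Bool
    isIndependent A = ⌊ Independent? A ⌋

    inSpan : Subset N → Vector n → Bool
    inSpan A u = ⌊ InSpan? A u ⌋

    Independent-⊆ : ∀ A s → (A ⊆ᵇ s) ≡ true → Independent s → Independent A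
    Independent-⊆ A s A⊆s indep c supp = indep c (λ i i∉s → supp i (∉-⊆ i i∉s))
      where
      ∉-⊆ : ∀ i → lookup s i ≡ false → lookup A i ≡ false
      ∉-⊆ i i∉s with lookup A i in i∈A
      ... | true  with () ← ≡.trans (≡.sym (⊆ᵇ-lookup A s A⊆s i i∈A)) i∉s
      ... | false = ≡.refl

    Independent-∅ : Independent ∅
    Independent-∅ c supp _ i = supp i (lookup-∅ i)

    InSpan-0V : ∀ A → InSpan A 0V
    InSpan-0V A = (λ _ → 0#) , (λ _ _ → refl) , lincomb-zero _ v (λ _ → refl)

    InSpan-· : ∀ A {w u} (t : Carrier) → InSpan A w → u ≋ (t · w) → InSpan A u
    InSpan-· A t (c , supp , lc≈w) u≈tw =
      (λ j → t * c j) , (λ j j∉A → trans (*-congˡ {t} (supp j j∉A)) (zeroʳ t)) ,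
      (λ k → trans (lincomb-* t c v k) (trans (*-congˡ {t} (lc≈w k)) (sym (u≈tw k))))

    δ : Fin N → Fin N → Carrier
    δ ℓ′ i = if i == ℓ′ then 1# else 0#

    δ-self : ∀ ℓ′ → δ ℓ′ ℓ′ ≈ 1#
    δ-self ℓ′ rewrite ==-refl ℓ′ = refl

    lincomb-δ : ∀ ℓ′ → lincomb (δ ℓ′) v ≋ v ℓ′
    lincomb-δ ℓ′ k = begin
      sumF (λ i → δ ℓ′ i * v i k) ≈⟨ sumF-single _ ℓ′ elsewhere ⟩
      δ ℓ′ ℓ′ * v ℓ′ k            ≈⟨ *-congʳ (δ-self ℓ′) ⟩
      1# * v ℓ′ k                 ≈⟨ *-identityˡ _ ⟩
      v ℓ′ k                      ∎
      where
      elsewhere : ∀ i → i ≢ ℓ′ → δ ℓ′ i * v i k ≈ 0#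
      elsewhere i i≢ℓ rewrite ≢⇒==-false i ℓ′ i≢ℓ = zeroˡ _

    ∈⇒InSpan : ∀ A ℓ′ → lookup A ℓ′ ≡ true → InSpan A (v ℓ′)
    ∈⇒InSpan A ℓ′ ℓ∈A = δ ℓ′ , supp , lincomb-δ ℓ′
      where
      supp : SupportedIn A (δ ℓ′)
      supp i i∉A with i == ℓ′ in i==ℓ
      ... | true with ≡.refl ← ==⇒≡ i ℓ′ i==ℓ with () ← ≡.trans (≡.sym ℓ∈A) i∉A
      ... | false = refl

    dropAt : Fin N → (Fin N → Carrier) → Fin N → Carrier
    dropAt ℓ′ c i = if i == ℓ′ then 0# else c i

    lincomb-dropAt : ∀ ℓ′ c k → lincomb c v k ≈ c ℓ′ * v ℓ′ k + lincomb (dropAt ℓ′ c) v k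
    lincomb-dropAt ℓ′ c k = begin
      sumF (λ i → c i * v i k)                                          ≈⟨ sumF-cong split ⟩
      sumF (λ i → (δ ℓ′ i * c ℓ′) * v i k + dropAt ℓ′ c i * v i k)
        ≈⟨ sumF-+ (λ i → (δ ℓ′ i * c ℓ′) * v i k) (λ i → dropAt ℓ′ c i * v i k) ⟩
      sumF (λ i → (δ ℓ′ i * c ℓ′) * v i k) + lincomb (dropAt ℓ′ c) v k ≈⟨ +-congʳ (sumF-single _ ℓ′ elsewhere) ⟩
      (δ ℓ′ ℓ′ * c ℓ′) * v ℓ′ k + lincomb (dropAt ℓ′ c) v k
        ≈⟨ +-congʳ (*-congʳ (trans (*-congʳ (δ-self ℓ′)) (*-identityˡ _))) ⟩
      c ℓ′ * v ℓ′ k + lincomb (dropAt ℓ′ c) v k                        ∎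
      where
      split : ∀ i → c i * v i k ≈ (δ ℓ′ i * c ℓ′) * v i k + dropAt ℓ′ c i * v i k
      split i with i == ℓ′ in i==ℓ
      ... | true rewrite ==⇒≡ i ℓ′ i==ℓ =
        sym (trans (+-congʳ (*-congʳ (*-identityˡ _))) (trans (+-congˡ (zeroˡ _)) (+-identityʳ _)))
      ... | false = sym (trans (+-congʳ (trans (*-congʳ (zeroˡ _)) (zeroˡ _))) (+-identityˡ _))
      elsewhere : ∀ i → i ≢ ℓ′ → (δ ℓ′ i * c ℓ′) * v i k ≈ 0#
      elsewhere i i≢ℓ rewrite ≢⇒==-false i ℓ′ i≢ℓ = trans (*-congʳ (zeroˡ _)) (zeroˡ _)

    SupportedIn-dropAt : ∀ A ℓ′ c → SupportedIn (insert ℓ′ A) c → SupportedIn A (dropAt ℓ′ c)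
    SupportedIn-dropAt A ℓ′ c supp i i∉A with i == ℓ′ in i==ℓ
    ... | true  = refl
    ... | false = supp i (≡.trans (lookup-insert ℓ′ A i) (≡.trans (≡.cong (_∨ lookup A i) i==ℓ) i∉A))

    -- A dependency Σ cᵢ vᵢ = 0 among A ∪ {ℓ} either has c_ℓ = 0, and is then a dependency
    -- among A, or expresses v_ℓ through A.
    Independent-insert : ∀ A ℓ′ → Independent A → ¬ InSpan A (v ℓ′) → Independent (insert ℓ′ A)
    Independent-insert A ℓ′ indep ℓ∉span c supp lc≈0 with c ℓ′ ≟ 0#
    ... | no cℓ≉0 = ⊥-elim (ℓ∉span ((λ i → t * dropAt ℓ′ c i) ,
                      (λ i i∉A → trans (*-congˡ {t} (SupportedIn-dropAt A ℓ′ c supp i i∉A)) (zeroʳ t)) ,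
                      (λ k → sym (trans (x*y+z≈0⇒y≈-x⁻¹*z _ _ _ cℓ≉0 (trans (sym (lincomb-dropAt ℓ′ c k)) (lc≈0 k)))
                                        (sym (lincomb-* t (dropAt ℓ′ c) v k))))))
      where t = - inv (c ℓ′) cℓ≉0
    ... | yes cℓ≈0 = c≈0
      where
      dropped≈0 : ∀ i → dropAt ℓ′ c i ≈ 0#
      dropped≈0 = indep (dropAt ℓ′ c) (SupportedIn-dropAt A ℓ′ c supp) (λ k → begin
        lincomb (dropAt ℓ′ c) v k               ≈⟨ +-identityˡ _ ⟨
        0# + lincomb (dropAt ℓ′ c) v k          ≈⟨ +-congʳ (trans (*-congʳ cℓ≈0) (zeroˡ _)) ⟨
        c ℓ′ * v ℓ′ k + lincomb (dropAt ℓ′ c) v k ≈⟨ lincomb-dropAt ℓ′ c k ⟨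
        lincomb c v k                           ≈⟨ lc≈0 k ⟩
        0#                                      ∎)
      c≈0 : ∀ i → c i ≈ 0#
      c≈0 i with i == ℓ′ in i==ℓ | dropped≈0 i
      ... | true  | _ rewrite ==⇒≡ i ℓ′ i==ℓ = cℓ≈0
      ... | false | cᵢ≈0 = cᵢ≈0

    Independent-insert⇒¬InSpan : ∀ A ℓ′ → lookup A ℓ′ ≡ false → Independent (insert ℓ′ A) → ¬ InSpan A (v ℓ′)
    Independent-insert⇒¬InSpan A ℓ′ ℓ∉A indep (c , supp , lc≈vℓ) = 1≉0 (begin
      1#              ≈⟨ -‿involutive 1# ⟨
      - (- 1#)        ≈⟨ -‿cong (+-identityˡ (- 1#)) ⟨
      - (0# + - 1#)   ≈⟨ -‿cong (+-congʳ (supp ℓ′ ℓ∉A)) ⟨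
      - (c ℓ′ + - 1#) ≈⟨ -‿cong (trans (+-congˡ (-‿cong (sym (δ-self ℓ′))))
                                       (indep d supp′ (lincomb-difference c (δ ℓ′) v c≋δ) ℓ′)) ⟩
      - 0#            ≈⟨ -0#≈0# ⟩
      0#              ∎)
      where
      d : Fin N → Carrier
      d i = c i + - δ ℓ′ i
      c≋δ : lincomb c v ≋ lincomb (δ ℓ′) v
      c≋δ k = trans (lc≈vℓ k) (sym (lincomb-δ ℓ′ k))
      supp′ : SupportedIn (insert ℓ′ A) d
      supp′ i i∉ℓA with i == ℓ′ in i==ℓ
      ... | true with () ← ≡.trans (≡.sym (≡.trans (lookup-insert ℓ′ A i) (≡.cong (_∨ lookup A i) i==ℓ))) i∉ℓA
      ... | false = trans (+-cong (supp i (≡.trans (≡.sym (≡.trans (lookup-insert ℓ′ A i) (≡.cong (_∨ lookup A i) i==ℓ))) i∉ℓA))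
                                 -0#≈0#) (+-identityʳ 0#)

    LinIndep⇒Independent : ∀ {k t} → Increasing k N t → LinIndep (v ∘ lookup t) → Independent (toSubset t)
    LinIndep⇒Independent {k} {t} I indep c supp lc≈0 i with lookup (toSubset t) i in i∈t
    ... | false = supp i i∈t
    ... | true with Increasing-lookup I i i∈t
    ...   | m , tₘ≡i = trans (reflexive (≡.cong c (≡.sym tₘ≡i))) (indep (c ∘ lookup t) restricted m)
      where
      restricted : lincomb (c ∘ lookup t) (v ∘ lookup t) ≋ 0V
      restricted k′ = trans (sym (sumF-Increasing I (λ j → c j * v j k′) (λ j j∉t → trans (*-congʳ (supp j j∉t)) (zeroˡ _))))
                            (lc≈0 k′)

    Independent⇒LinIndep : ∀ {k t} → Increasing k N t → Independent (toSubset t) → LinIndep (v ∘ lookup t)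
    Independent⇒LinIndep {k} {t} I indep c lc≈0 m =
      trans (sym (reflexive (spread-lookup I c m))) (indep (spread I c) (spread-outside I c) spread≈0 (lookup t m))
      where
      spread≈0 : lincomb (spread I c) v ≋ 0V
      spread≈0 k′ = begin
        sumF (λ j → spread I c j * v j k′)
          ≈⟨ sumF-Increasing I (λ j → spread I c j * v j k′) (λ j j∉t → trans (*-congʳ (spread-outside I c j j∉t)) (zeroˡ _)) ⟩
        sumF (λ m → spread I c (lookup t m) * v (lookup t m) k′) ≈⟨ sumF-cong (λ m → *-congʳ (reflexive (spread-lookup I c m))) ⟩
        lincomb c (v ∘ lookup t) k′                              ≈⟨ lc≈0 k′ ⟩
        0#                                                       ∎

    isBasis≡isIndependent : ∀ {t} → Increasing n N t → ⌊ isBasis? (v ∘ lookup t) ⌋ ≡ isIndependent (toSubset t)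
    isBasis≡isIndependent {t} I with isBasis? (v ∘ lookup t) | Independent? (toSubset t)
    ... | yes _           | yes _     = ≡.refl
    ... | yes (indep , _) | no ¬indep = ⊥-elim (¬indep (LinIndep⇒Independent I indep))
    ... | no ¬basis       | yes indep = ⊥-elim (¬basis (Independent⇒LinIndep I indep , LinIndep⇒Spans _ (Independent⇒LinIndep I indep)))
    ... | no _            | no _      = ≡.refl

    supportedIn⇒SupportedIn : ∀ {N′} (A : Subset N′) (g : Fin N′ → Fin q) → supportedIn zeroIndex A g ≡ true →
      ∀ i → lookup A i ≡ false → enum (g i) ≈ 0#
    supportedIn⇒SupportedIn (false ∷ A) g supp zero _ with g zero == zeroIndex in g₀==0
    ... | true rewrite ==⇒≡ (g zero) zeroIndex g₀==0 = enum-zeroIndex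
    supportedIn⇒SupportedIn (a ∷ A) g supp (suc i) i∉A with a ∨ (g zero == zeroIndex)
    ... | true = supportedIn⇒SupportedIn A (g ∘ suc) supp i i∉A

    SupportedIn⇒supportedIn : ∀ {N′} (A : Subset N′) (g : Fin N′ → Fin q) →
      (∀ i → lookup A i ≡ false → enum (g i) ≈ 0#) → supportedIn zeroIndex A g ≡ true
    SupportedIn⇒supportedIn []          g _    = ≡.refl
    SupportedIn⇒supportedIn (true ∷ A)  g supp = SupportedIn⇒supportedIn A (g ∘ suc) (supp ∘ suc)
    SupportedIn⇒supportedIn (false ∷ A) g supp rewrite enum≈0⇒≡zeroIndex (g zero) (supp zero ≡.refl) | ==-refl zeroIndex =
      SupportedIn⇒supportedIn A (g ∘ suc) (supp ∘ suc)

    -- c ↦ Σ cᵢ vᵢ is a bijection from the coefficient vectors supported in A onto span A.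
    count-inSpan : ∀ A → Independent A → count {q ^ n} (inSpan A ∘ decode {n}) ≡ q ^ size A
    count-inSpan A indep = ≡.trans (≡.sym (count-bijection supported spanned φ maps injective onto))
                                   (count-supportedIn zeroIndex N A)
      where
      supported : Fin (q ^ N) → Bool
      supported y = supportedIn zeroIndex A (finToFun y)
      spanned : Fin (q ^ n) → Bool
      spanned x = inSpan A (decode {n} x)
      φ : Fin (q ^ N) → Fin (q ^ n)
      φ y = encode {n} (lincomb (decode {N} y) v)
      maps : MapsTo supported spanned φ
      maps y y-supp = ⌊⌋-yes (InSpan? A _)
        (decode {N} y , supportedIn⇒SupportedIn A (finToFun y) y-supp , λ k → sym (decode-encode _ k))
      injective : InjectiveOn supported spanned φ
      injective x y x-supp y-supp φx≡φy = decode-injective {N} (λ i →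
        x∙y⁻¹≈ε⇒x≈y _ _ (indep _ difference-supp (lincomb-difference _ _ v (encode-injective {n} φx≡φy)) i))
        where
        difference-supp : SupportedIn A (λ j → decode {N} x j + - decode {N} y j)
        difference-supp j j∉A =
          trans (+-cong (supportedIn⇒SupportedIn A (finToFun x) x-supp j j∉A)
                        (-‿cong (supportedIn⇒SupportedIn A (finToFun y) y-supp j j∉A)))
                (trans (+-congˡ -0#≈0#) (+-identityʳ 0#))
      onto : SurjectiveOnto supported spanned φ
      onto x x-spanned with ⌊⌋-yes⁻¹ (InSpan? A (decode {n} x)) x-spanned
      ... | c , supp , lc≈x = encode {N} c ,
        SupportedIn⇒supportedIn A (finToFun (encode {N} c)) (λ i i∉A → trans (decode-encode c i) (supp i i∉A)) ,
        ≡.trans (encode-cong (λ k → trans (lincomb-cong v (decode-encode c) k) (lc≈x k))) (encode-decode {n} x)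

module Supersets {a ℓ q} (𝔽 : FiniteField a ℓ q) {n N : ℕ} (v : Fin N → LinAlg.Vector 𝔽 n) where

  open import Defs using (FiniteField; module LinAlg)
  open import Data.Nat using (ℕ; zero; suc; _≡ᵇ_; _!)
  import Data.Nat as ℕ
  import Data.Nat.Properties as ℕ
  open import Data.Fin using (Fin)
  open import Data.Bool using (true; false; not; _∧_)
  open import Data.Empty using (⊥-elim)
  open import Data.Vec using (lookup)
  open import Relation.Nullary using (yes; no; ¬_)
  import Relation.Binary.PropositionalEquality as ≡
  open ≡ using (_≡_)

  open Counting
  open Subsets

  open LinearAlgebra 𝔽
  open Family v

  supersetCount-dependent : ∀ k A → ¬ Independent A → supersetCount k A isIndependent ≡ 0
  supersetCount-dependent k A ¬indep = sumSubsets-zero _ none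
    where
    none : ∀ s → 𝟙 ((A ⊆ᵇ s) ∧ ((size s ≡ᵇ k ℕ.+ size A) ∧ isIndependent s)) ≡ 0
    none s with A ⊆ᵇ s in A⊆s | isIndependent s in s-indep
    ... | false | _     = ≡.refl
    ... | true  | false with size s ≡ᵇ k ℕ.+ size A
    ...   | true  = ≡.refl
    ...   | false = ≡.refl
    none s | true | true = ⊥-elim (¬indep (Independent-⊆ A s A⊆s (⌊⌋-yes⁻¹ (Independent? s) s-indep)))

  -- Add the k new elements one at a time, in each of the k! orders: at every step the current
  -- independent set B has exactly L |B| independent one-element extensions.
  factorial*supersetCount : (L : ℕ → ℕ) →
    (∀ A → Independent A → count (λ ℓ′ → not (inSpan A (v ℓ′))) ≡ L (size A)) →
    ∀ k A → Independent A → k ! ℕ.* supersetCount k A isIndependent ≡ risingProduct L k (size A)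
  factorial*supersetCount L extensions zero A indep =
    ≡.trans (ℕ.+-identityʳ _) (≡.trans (supersetCount-zero A isIndependent) (≡.cong 𝟙 (⌊⌋-yes (Independent? A) indep)))
  factorial*supersetCount L extensions (suc k) A indep = begin
    suc k ! ℕ.* G                ≡⟨ ℕ.*-assoc (suc k) (k !) G ⟩
    suc k ℕ.* (k ! ℕ.* G)        ≡⟨ ≡.cong (suc k ℕ.*_) (ℕ.*-comm (k !) G) ⟩
    suc k ℕ.* (G ℕ.* k !)        ≡⟨ ℕ.*-assoc (suc k) G (k !) ⟨
    suc k ℕ.* G ℕ.* k !
      ≡⟨ ≡.cong (ℕ._* k !) (supersetCount-suc k A isIndependent) ⟩
    sum (λ ℓ′ → 𝟙 (not (lookup A ℓ′)) ℕ.* supersetCount k (insert ℓ′ A) isIndependent) ℕ.* k !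
      ≡⟨ *-distribʳ-sum (λ ℓ′ → 𝟙 (not (lookup A ℓ′)) ℕ.* supersetCount k (insert ℓ′ A) isIndependent) (k !) ⟨
    sum (λ ℓ′ → 𝟙 (not (lookup A ℓ′)) ℕ.* supersetCount k (insert ℓ′ A) isIndependent ℕ.* k !)
      ≡⟨ sum-cong-≗ extend ⟩
    sum (λ ℓ′ → 𝟙 (not (inSpan A (v ℓ′))) ℕ.* R)
      ≡⟨ *-distribʳ-sum (λ ℓ′ → 𝟙 (not (inSpan A (v ℓ′)))) R ⟩
    count (λ ℓ′ → not (inSpan A (v ℓ′))) ℕ.* R
      ≡⟨ ≡.cong (ℕ._* R) (extensions A indep) ⟩
    L (size A) ℕ.* R ∎
    where
    open ≡.≡-Reasoning
    G = supersetCount (suc k) A isIndependent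
    R = risingProduct L k (suc (size A))
    extend : ∀ ℓ′ → 𝟙 (not (lookup A ℓ′)) ℕ.* supersetCount k (insert ℓ′ A) isIndependent ℕ.* k !
                  ≡ 𝟙 (not (inSpan A (v ℓ′))) ℕ.* R
    extend ℓ′ with lookup A ℓ′ in ℓ∈A
    ... | true rewrite ⌊⌋-yes (InSpan? A (v ℓ′)) (∈⇒InSpan A ℓ′ ℓ∈A) = ≡.refl
    ... | false with Independent? (insert ℓ′ A)
    ...   | yes indep′ rewrite ⌊⌋-no (InSpan? A (v ℓ′)) (Independent-insert⇒¬InSpan A ℓ′ ℓ∈A indep′) = begin
      (G′ ℕ.+ 0) ℕ.* k !                    ≡⟨ ≡.cong (ℕ._* k !) (ℕ.+-identityʳ G′) ⟩
      G′ ℕ.* k !                            ≡⟨ ℕ.*-comm G′ (k !) ⟩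
      k ! ℕ.* G′                            ≡⟨ factorial*supersetCount L extensions k (insert ℓ′ A) indep′ ⟩
      risingProduct L k (size (insert ℓ′ A)) ≡⟨ ≡.cong (risingProduct L k) (size-insert ℓ′ A ℓ∈A) ⟩
      R                                     ≡⟨ ℕ.+-identityʳ R ⟨
      R ℕ.+ 0                               ∎
      where G′ = supersetCount k (insert ℓ′ A) isIndependent
    ...   | no ¬indep′ with InSpan? A (v ℓ′)
    ...     | yes _ rewrite supersetCount-dependent k (insert ℓ′ A) ¬indep′ = ≡.refl
    ...     | no ℓ∉span = ⊥-elim (¬indep′ (Independent-insert A ℓ′ indep ℓ∉span))

module LineCounting {a ℓ q} (𝔽 : FiniteField a ℓ q) {n N : ℕ} (v : Fin N → LinAlg.Vector 𝔽 n)
                    (lines : LinAlg.IsLineEnumeration 𝔽 n N v) where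

  open import Defs using (FiniteField; module LinAlg)
  open import Data.Nat using (ℕ; _∸_; _^_)
  import Data.Nat as ℕ
  import Data.Nat.Properties as ℕ
  open import Data.Fin using (Fin)
  open import Data.Fin.Properties using (any?)
  open import Data.Bool using (Bool; true; false; not; _∧_; _∨_)
  import Data.Bool as Bool
  open import Data.Vec using (lookup)
  open import Data.Product using (_×_; _,_; ∃)
  open import Data.Empty using (⊥-elim)
  open import Function using (_∘_)
  open import Relation.Nullary using (yes; no; ¬_; Dec)
  open import Relation.Nullary.Decidable using (⌊_⌋; _×-dec_)
  import Relation.Binary.PropositionalEquality as ≡
  open ≡ using (_≡_; _≢_)

  open Counting
  open Subsets

  open FiniteField 𝔽
  open LinAlg 𝔽 hiding (sumF-cong)
  open LinearAlgebra 𝔽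
  open Family v
  open IsLineEnumeration lines
  open FieldFacts field′ using (sumF-single)

  OnLine : Fin N → Vector n → Set ℓ
  OnLine ℓ′ u = ∃ λ (t : Fin q) → (t == zeroIndex) ≡ false × (u ≋ (enum t · v ℓ′))

  OnLine? : ∀ ℓ′ u → Dec (OnLine ℓ′ u)
  OnLine? ℓ′ u = any? (λ t → ((t == zeroIndex) Bool.≟ false) ×-dec ≋? u (enum t · v ℓ′))

  onLine : Fin N → Vector n → Bool
  onLine ℓ′ u = ⌊ OnLine? ℓ′ u ⌋

  enum≉0 : ∀ t → (t == zeroIndex) ≡ false → ¬ (enum t ≈ 0#)
  enum≉0 t t≢0 t≈0 = ==-false⇒≢ t zeroIndex t≢0 (enum≈0⇒≡zeroIndex t t≈0)

  count-onLine : ∀ ℓ′ → count {q ^ n} (onLine ℓ′ ∘ decode {n}) ≡ q ∸ 1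
  count-onLine ℓ′ = ≡.trans (≡.sym (count-bijection nonzero? onLine′ φ maps injective onto)) (count-≠ zeroIndex)
    where
    nonzero? : Fin q → Bool
    nonzero? t = not (t == zeroIndex)
    onLine′ : Fin (q ^ n) → Bool
    onLine′ = onLine ℓ′ ∘ decode {n}
    φ : Fin q → Fin (q ^ n)
    φ t = encode {n} (enum t · v ℓ′)
    maps : MapsTo nonzero? onLine′ φ
    maps t t≢0 = ⌊⌋-yes (OnLine? ℓ′ _) (t , not-true t≢0 , decode-encode _)
      where
      not-true : ∀ {b} → not b ≡ true → b ≡ false
      not-true {false} _ = ≡.refl
    injective : InjectiveOn nonzero? onLine′ φ
    injective t t′ _ _ φt≡φt′ =
      enum-inj t t′ (·-cancelʳ (enum t) (enum t′) (v ℓ′) (encode-injective {n} φt≡φt′) (nonzero ℓ′))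
    onto : SurjectiveOnto nonzero? onLine′ φ
    onto x x-onLine with ⌊⌋-yes⁻¹ (OnLine? ℓ′ _) x-onLine
    ... | t , t≢0 , x≋tv = t , ≡.cong not t≢0 , ≡.trans (encode-cong (λ k → sym (x≋tv k))) (encode-decode {n} x)

  OnLine-unique : ∀ {u} ℓ₀ μ → u ≋ (μ · v ℓ₀) → ∀ ℓ′ → OnLine ℓ′ u → ℓ′ ≡ ℓ₀
  OnLine-unique ℓ₀ μ u≋μv ℓ′ (t , t≢0 , u≋tv) = distinct ℓ′ ℓ₀ (inv (enum t) (enum≉0 t t≢0) * μ) (λ k →
    trans (·-inverse (enum t) (enum≉0 t t≢0) u≋tv k)
          (trans (*-congˡ {inv (enum t) (enum≉0 t t≢0)} (u≋μv k)) (sym (*-assoc _ _ _))))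

  -- Each nonzero vector lies on exactly one line, which is outside span A iff the vector is.
  outsideSpan-onLines : ∀ A (u : Vector n) →
    𝟙 (not (inSpan A u)) ≡ sum (λ ℓ′ → 𝟙 (onLine ℓ′ u ∧ not (inSpan A (v ℓ′))))
  outsideSpan-onLines A u with ≋? u 0V
  ... | yes u≋0 = ≡.trans (≡.cong (λ b → 𝟙 (not b)) (⌊⌋-yes (InSpan? A u) u∈span))
                          (≡.sym (sum-zero _ (λ ℓ′ → ≡.cong (λ b → 𝟙 (b ∧ not (inSpan A (v ℓ′)))) (⌊⌋-no (OnLine? ℓ′ u) (offLines ℓ′)))))
    where
    u∈span : InSpan A u
    u∈span = InSpan-· A 0# (InSpan-0V A) (λ k → trans (u≋0 k) (sym (zeroˡ _)))
    offLines : ∀ ℓ′ → ¬ OnLine ℓ′ u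
    offLines ℓ′ (t , t≢0 , u≋tv) = nonzero ℓ′ (λ k →
      trans (·-inverse (enum t) (enum≉0 t t≢0) u≋tv k) (trans (*-congˡ {inv (enum t) (enum≉0 t t≢0)} (u≋0 k)) (zeroʳ _)))
  ... | no u≉0 with covers u u≉0
  ...   | ℓ₀ , μ , u≋μv = ≡.trans (≡.cong (λ b → 𝟙 (not b)) sameSpan) (≡.sym (≡.trans (sum-single _ ℓ₀ others) onℓ₀))
    where
    μ≉0 : ¬ (μ ≈ 0#)
    μ≉0 μ≈0 = u≉0 (λ k → trans (u≋μv k) (trans (*-congʳ μ≈0) (zeroˡ _)))
    index≡zeroIndex : index μ ≡ zeroIndex → μ ≈ 0#
    index≡zeroIndex e = trans (sym (enum-index μ)) (trans (reflexive (≡.cong enum e)) enum-zeroIndex)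
    onℓ₀ : 𝟙 (onLine ℓ₀ u ∧ not (inSpan A (v ℓ₀))) ≡ 𝟙 (not (inSpan A (v ℓ₀)))
    onℓ₀ rewrite ⌊⌋-yes (OnLine? ℓ₀ u) (index μ , ≢⇒==-false (index μ) zeroIndex (μ≉0 ∘ index≡zeroIndex) ,
                                            λ k → trans (u≋μv k) (*-congʳ (sym (enum-index μ)))) = ≡.refl
    others : ∀ ℓ′ → ℓ′ ≢ ℓ₀ → 𝟙 (onLine ℓ′ u ∧ not (inSpan A (v ℓ′))) ≡ 0
    others ℓ′ ℓ′≢ℓ₀ rewrite ⌊⌋-no (OnLine? ℓ′ u) (ℓ′≢ℓ₀ ∘ OnLine-unique ℓ₀ μ u≋μv ℓ′) = ≡.refl
    sameSpan : inSpan A u ≡ inSpan A (v ℓ₀)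
    sameSpan with InSpan? A u | InSpan? A (v ℓ₀)
    ... | yes _   | yes _   = ≡.refl
    ... | no _    | no _    = ≡.refl
    ... | yes u∈A | no vℓ∉A = ⊥-elim (vℓ∉A (InSpan-· A (inv μ μ≉0) u∈A (·-inverse μ μ≉0 u≋μv)))
    ... | no u∉A  | yes vℓ∈A = ⊥-elim (u∉A (InSpan-· A μ vℓ∈A u≋μv))

  -- Counting the vectors outside span A line by line: q ^ n - q ^ |A| = (q - 1) · #{lines outside span A}.
  count-linesOutsideSpan : ∀ A → Independent A →
    (q ∸ 1) ℕ.* count (λ ℓ′ → not (inSpan A (v ℓ′))) ≡ q ^ n ∸ q ^ size A
  count-linesOutsideSpan A indep = begin
    (q ∸ 1) ℕ.* count outside                                         ≡⟨ outsideVectors ⟨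
    count {q ^ n} (not ∘ inSpan A ∘ decode {n})                      ≡⟨ ℕ.m+n∸m≡n (q ^ size A) _ ⟨
    q ^ size A ℕ.+ count {q ^ n} (not ∘ inSpan A ∘ decode {n}) ∸ q ^ size A
      ≡⟨ ≡.cong (λ k → k ℕ.+ count {q ^ n} (not ∘ inSpan A ∘ decode {n}) ∸ q ^ size A) (count-inSpan A indep) ⟨
    count {q ^ n} (inSpan A ∘ decode {n}) ℕ.+ count {q ^ n} (not ∘ inSpan A ∘ decode {n}) ∸ q ^ size A
      ≡⟨ ≡.cong (_∸ q ^ size A) (count-complement {q ^ n} (inSpan A ∘ decode {n})) ⟩
    q ^ n ∸ q ^ size A                                              ∎
    where
    open ≡.≡-Reasoning
    outside : Fin N → Bool
    outside ℓ′ = not (inSpan A (v ℓ′))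
    outsideVectors : count {q ^ n} (not ∘ inSpan A ∘ decode {n}) ≡ (q ∸ 1) ℕ.* count outside
    outsideVectors = begin
      sum (λ x → 𝟙 (not (inSpan A (decode {n} x))))
        ≡⟨ sum-cong-≗ (λ x → outsideSpan-onLines A (decode {n} x)) ⟩
      sum (λ x → sum (λ ℓ′ → 𝟙 (onLine ℓ′ (decode {n} x) ∧ outside ℓ′)))
        ≡⟨ ∑-comm (λ x ℓ′ → 𝟙 (onLine ℓ′ (decode {n} x) ∧ outside ℓ′)) ⟩
      sum (λ ℓ′ → sum (λ x → 𝟙 (onLine ℓ′ (decode {n} x) ∧ outside ℓ′)))
        ≡⟨ sum-cong-≗ (λ ℓ′ → ≡.trans (sum-cong-≗ (λ x → 𝟙-∧ (onLine ℓ′ (decode {n} x)) (outside ℓ′)))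
                                     (*-distribʳ-sum (λ x → 𝟙 (onLine ℓ′ (decode {n} x))) (𝟙 (outside ℓ′)))) ⟩
      sum (λ ℓ′ → count {q ^ n} (onLine ℓ′ ∘ decode {n}) ℕ.* 𝟙 (outside ℓ′))
        ≡⟨ sum-cong-≗ (λ ℓ′ → ≡.cong (ℕ._* 𝟙 (outside ℓ′)) (count-onLine ℓ′)) ⟩
      sum (λ ℓ′ → (q ∸ 1) ℕ.* 𝟙 (outside ℓ′))
        ≡⟨ *-distribˡ-sum (q ∸ 1) (𝟙 ∘ outside) ⟨
      (q ∸ 1) ℕ.* count outside ∎

  Independent-pair : ∀ i j → i ≢ j → Independent (pair i j)
  Independent-pair i j i≢j = Independent-insert (insert j ∅) i (Independent-insert ∅ j Independent-∅ vⱼ∉span) vᵢ∉span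
    where
    vⱼ∉span : ¬ InSpan ∅ (v j)
    vⱼ∉span (c , supp , lc≈vⱼ) = nonzero j (λ k → trans (sym (lc≈vⱼ k)) (lincomb-zero c v (λ i′ → supp i′ (lookup-∅ i′)) k))
    vᵢ∉span : ¬ InSpan (insert j ∅) (v i)
    vᵢ∉span (c , supp , lc≈vᵢ) = i≢j (distinct i j (c j) (λ k → trans (sym (lc≈vᵢ k)) (sumF-single _ j (others k))))
      where
      others : ∀ k i′ → i′ ≢ j → c i′ * v i′ k ≈ 0#
      others k i′ i′≢j = trans (*-congʳ (supp i′ (≡.trans (lookup-insert j ∅ i′)
                           (≡.trans (≡.cong (_∨ lookup ∅ i′) (≢⇒==-false i′ j i′≢j)) (lookup-∅ i′))))) (zeroˡ _)

module QArithmetic (r : ℕ) where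

  open import Defs using (qNum; prodFrom1)
  open import Data.Nat
  open import Data.Nat.Properties
  open import Data.Nat.DivMod using (_/_; m*n/n≡m)
  open import Data.Nat.Tactic.RingSolver using (solve-∀)
  open import Relation.Binary.PropositionalEquality
  open import Function using (_∘_)

  open Subsets using (risingProduct)

  q : ℕ
  q = suc (suc r)

  [_]q : ℕ → ℕ
  [ zero  ]q = 0
  [ suc k ]q = 1 + q * [ k ]q

  *-/-cancel : ∀ X → (suc r * X) / suc r ≡ X
  *-/-cancel X = trans (cong (_/ suc r) (*-comm (suc r) X)) (m*n/n≡m X (suc r))

  [k]q-spec : ∀ k → q ^ k ∸ 1 ≡ suc r * [ k ]q
  [k]q-spec k = trans (cong (_∸ 1) (sym (geometric k))) (m+n∸n≡m _ 1)
    where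
    geometric : ∀ k → suc r * [ k ]q + 1 ≡ q ^ k
    geometric zero    = cong (_+ 1) (*-zeroʳ r)
    geometric (suc k) = trans (step r [ k ]q) (cong (q *_) (geometric k))
      where
      step : ∀ r g → suc r * (1 + suc (suc r) * g) + 1 ≡ suc (suc r) * (suc r * g + 1)
      step = solve-∀

  qNum≡[k]q : ∀ k → qNum q k ≡ [ k ]q
  qNum≡[k]q k = trans (cong (_/ suc r) ([k]q-spec k)) (*-/-cancel [ k ]q)

  -- (q ^ n - q ^ d) / (q - 1), the number of lines outside a d-dimensional subspace of 𝔽 ^ n
  linesOutside : ℕ → ℕ → ℕ
  linesOutside n d = (q ^ n ∸ q ^ d) / suc r

  linesOutside-unique : ∀ n d X → suc r * X ≡ q ^ n ∸ q ^ d → X ≡ linesOutside n d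
  linesOutside-unique n d X eq = trans (sym (*-/-cancel X)) (cong (_/ suc r) eq)

  linesOutside-+ : ∀ d k → linesOutside (d + k) d ≡ q ^ d * [ k ]q
  linesOutside-+ d k = sym (linesOutside-unique (d + k) d (q ^ d * [ k ]q) (begin
    suc r * (q ^ d * [ k ]q)    ≡⟨ x∙yz≈y∙xz (suc r) (q ^ d) [ k ]q ⟩
    q ^ d * (suc r * [ k ]q)    ≡⟨ cong (q ^ d *_) ([k]q-spec k) ⟨
    q ^ d * (q ^ k ∸ 1)         ≡⟨ *-distribˡ-∸ (q ^ d) (q ^ k) 1 ⟩
    q ^ d * q ^ k ∸ q ^ d * 1   ≡⟨ cong₂ _∸_ (^-distribˡ-+-* q d k) (sym (*-identityʳ (q ^ d))) ⟨
    q ^ (d + k) ∸ q ^ d         ∎))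
    where
    open ≡-Reasoning
    x∙yz≈y∙xz : ∀ x y z → x * (y * z) ≡ y * (x * z)
    x∙yz≈y∙xz = solve-∀

  exponentSum : ℕ → ℕ → ℕ
  exponentSum zero    d = 0
  exponentSum (suc k) d = d + exponentSum k (suc d)

  risingProduct-linesOutside : ∀ k d n → d + k ≡ n →
    risingProduct (linesOutside n) k d ≡ q ^ exponentSum k d * prodFrom1 k [_]q
  risingProduct-linesOutside zero    d n _       = refl
  risingProduct-linesOutside (suc k) d n d+k+1≡n = begin
    linesOutside n d * risingProduct (linesOutside n) k (suc d)
      ≡⟨ cong₂ _*_ (trans (cong (λ n → linesOutside n d) (sym d+k+1≡n)) (linesOutside-+ d (suc k)))
                   (risingProduct-linesOutside k (suc d) n (trans (sym (+-suc d k)) d+k+1≡n)) ⟩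
    q ^ d * [ suc k ]q * (q ^ exponentSum k (suc d) * prodFrom1 k [_]q)
      ≡⟨ regroup (q ^ d) [ suc k ]q (q ^ exponentSum k (suc d)) (prodFrom1 k [_]q) ⟩
    q ^ d * q ^ exponentSum k (suc d) * (prodFrom1 k [_]q * [ suc k ]q)
      ≡⟨ cong (_* (prodFrom1 k [_]q * [ suc k ]q)) (^-distribˡ-+-* q d (exponentSum k (suc d))) ⟨
    q ^ (d + exponentSum k (suc d)) * (prodFrom1 k [_]q * [ suc k ]q) ∎
    where
    open ≡-Reasoning
    regroup : ∀ a b c e → a * b * (c * e) ≡ a * c * (e * b)
    regroup = solve-∀

  2*exponentSum : ∀ k d → 2 * exponentSum k d + k ≡ k * (2 * d + k)
  2*exponentSum zero    d = refl
  2*exponentSum (suc k) d = begin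
    2 * (d + exponentSum k (suc d)) + suc k             ≡⟨ split d k (exponentSum k (suc d)) ⟩
    (2 * exponentSum k (suc d) + k) + (2 * d + 1)       ≡⟨ cong (_+ (2 * d + 1)) (2*exponentSum k (suc d)) ⟩
    k * (2 * suc d + k) + (2 * d + 1)                   ≡⟨ merge d k ⟩
    suc k * (2 * d + suc k)                             ∎
    where
    open ≡-Reasoning
    split : ∀ d k X → 2 * (d + X) + suc k ≡ (2 * X + k) + (2 * d + 1)
    split = solve-∀
    merge : ∀ d k → k * (2 * suc d + k) + (2 * d + 1) ≡ suc k * (2 * d + suc k)
    merge = solve-∀

  halfExponent≡exponentSum : ∀ m → ((m + 2) * (m + 2) ∸ (m + 2) ∸ 2) / 2 ≡ exponentSum m 2
  halfExponent≡exponentSum m = begin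
    ((m + 2) * (m + 2) ∸ (m + 2) ∸ 2) / 2            ≡⟨ cong (λ z → (z ∸ (m + 2) ∸ 2) / 2) square ⟩
    ((2 * E + 2) + (m + 2) ∸ (m + 2) ∸ 2) / 2        ≡⟨ cong (λ z → (z ∸ 2) / 2) (m+n∸n≡m (2 * E + 2) (m + 2)) ⟩
    (2 * E + 2 ∸ 2) / 2                              ≡⟨ cong (_/ 2) (m+n∸n≡m (2 * E) 2) ⟩
    (2 * E) / 2                                      ≡⟨ cong (_/ 2) (*-comm 2 E) ⟩
    (E * 2) / 2                                      ≡⟨ m*n/n≡m E 2 ⟩
    E                                                ∎
    where
    open ≡-Reasoning
    E = exponentSum m 2
    expand : ∀ m → (m + 2) * (m + 2) ≡ m * (2 * 2 + m) + 4
    expand = solve-∀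
    regroup : ∀ E m → E + m + 4 ≡ (E + 2) + (m + 2)
    regroup = solve-∀
    square : (m + 2) * (m + 2) ≡ (2 * E + 2) + (m + 2)
    square = trans (expand m) (trans (cong (_+ 4) (sym (2*exponentSum m 2))) (regroup (2 * E) m))

  prodFrom1-cong : ∀ k (f g : ℕ → ℕ) → (∀ i → f i ≡ g i) → prodFrom1 k f ≡ prodFrom1 k g
  prodFrom1-cong zero    f g f≡g = refl
  prodFrom1-cong (suc k) f g f≡g = cong₂ _*_ (prodFrom1-cong k f g f≡g) (f≡g (suc k))

  risingProduct-linesOutside-from2 : ∀ n → 2 ≤ n →
    risingProduct (linesOutside n) (n ∸ 2) 2 ≡ q ^ ((n * n ∸ n ∸ 2) / 2) * prodFrom1 (n ∸ 2) (qNum q)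
  risingProduct-linesOutside-from2 (suc (suc m)) (s≤s (s≤s z≤n)) = begin
    risingProduct (linesOutside (suc (suc m))) m 2
      ≡⟨ risingProduct-linesOutside m 2 (suc (suc m)) refl ⟩
    q ^ exponentSum m 2 * prodFrom1 m [_]q
      ≡⟨ cong₂ (λ e p → q ^ e * p) (sym exponent) (prodFrom1-cong m [_]q (qNum q) (sym ∘ qNum≡[k]q)) ⟩
    q ^ ((suc (suc m) * suc (suc m) ∸ suc (suc m) ∸ 2) / 2) * prodFrom1 m (qNum q) ∎
    where
    open ≡-Reasoning
    exponent : (suc (suc m) * suc (suc m) ∸ suc (suc m) ∸ 2) / 2 ≡ exponentSum m 2
    exponent = trans (cong (λ z → (z * z ∸ z ∸ 2) / 2) (+-comm 2 m)) (halfExponent≡exponentSum m)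

module Hessian {a ℓ} (K : Field a ℓ) where

  open import Defs using (Field; module PolyOps; monomialExp)
  open import Data.Nat using (ℕ; _∸_)
  import Data.Nat as ℕ
  import Data.Nat.Properties as ℕ
  open import Data.Nat.ListAction using () renaming (sum to sumList)
  open import Data.Fin using (Fin)
  open import Data.Fin.Properties using () renaming (_≟_ to _≟ᶠ_)
  open import Data.Bool using (if_then_else_)
  open import Data.Vec using (Vec)
  open import Data.List using (List; []; _∷_; filter)
  import Data.List as List
  open import Data.Product using (_,_)
  open import Function using (_∘′_)
  open import Relation.Nullary using (yes; no)
  open import Relation.Nullary.Decidable using (⌊_⌋)
  open import Relation.Unary using (Pred; Decidable)
  import Relation.Binary.PropositionalEquality as ≡
  open ≡ using (_≡_)

  open Counting using (𝟙)
  open IncreasingTuples using (∂∂-coefficient)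

  open Field K
  open PolyOps K
  open FieldFacts K
  open import Relation.Binary.Reasoning.Setoid setoid

  hessian1-sumOfMonomials : ∀ {n N} (ts : List (Vec (Fin N) n)) (i j : Fin N) →
    eval1 (∂ i (∂ j (List.map (λ t → 1# , monomialExp t) ts)))
      ≈ fromℕ (sumList (List.map (∂∂-coefficient i j ∘′ monomialExp) ts))
  hessian1-sumOfMonomials []       i j = refl
  hessian1-sumOfMonomials (t ∷ ts) i j = begin
    (1# * fromℕ (monomialExp t j)) * fromℕ (if ⌊ i ≟ᶠ j ⌋ then monomialExp t j ∸ 1 else monomialExp t i)
      + eval1 (∂ i (∂ j (List.map (λ t → 1# , monomialExp t) ts)))
      ≈⟨ +-cong (trans (*-congʳ (*-identityˡ _)) (sym (fromℕ-* (monomialExp t j) _))) (hessian1-sumOfMonomials ts i j) ⟩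
    fromℕ (∂∂-coefficient i j (monomialExp t)) + fromℕ (sumList (List.map (∂∂-coefficient i j ∘′ monomialExp) ts))
      ≈⟨ fromℕ-+ (∂∂-coefficient i j (monomialExp t)) _ ⟨
    fromℕ (∂∂-coefficient i j (monomialExp t) ℕ.+ sumList (List.map (∂∂-coefficient i j ∘′ monomialExp) ts)) ∎

  sumList-filter : ∀ {A : Set} {p} {P : Pred A p} (P? : Decidable P) (g : A → ℕ) (xs : List A) →
    sumList (List.map g (filter P? xs)) ≡ sumList (List.map (λ x → 𝟙 ⌊ P? x ⌋ ℕ.* g x) xs)
  sumList-filter P? g []       = ≡.refl
  sumList-filter P? g (x ∷ xs) with P? x
  ... | yes _ = ≡.cong₂ ℕ._+_ (≡.sym (ℕ.+-identityʳ (g x))) (sumList-filter P? g xs)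
  ... | no  _ = sumList-filter P? g xs

open import Data.Nat using (zero; suc; _≡ᵇ_; _!; s≤s; z≤n)
import Data.Nat as ℕ
import Data.Nat.Properties as ℕ
open import Data.Nat.ListAction using () renaming (sum to sumList)
open import Data.Fin using (zero; suc)
open import Data.Bool using (Bool; true; false; not; _∧_)
open import Data.Vec using (Vec; lookup)
open import Data.List using (filter)
import Data.List as List
import Data.List.Relation.Unary.All as All
open import Data.Product using (_,_; proj₁)
open import Data.Empty using (⊥-elim)
open import Function using (_∘_)
open import Relation.Nullary.Decidable using (⌊_⌋)
import Relation.Binary.PropositionalEquality as ≡
open ≡ using (_≢_)

open Counting
open Subsets
open IncreasingTuples

module BasisPolynomialHessian {a ℓ a′ ℓ′ q} (𝔽 : FiniteField a ℓ q) (n N : ℕ)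
                              (v : Fin N → LinAlg.Vector 𝔽 n) (K : Field a′ ℓ′) where

  open Field K
  open PolyOps K
  open FieldFacts K
  open Hessian K
  open LinearAlgebra 𝔽 using (module Family)
  open Family v

  H : Fin N → Fin N → Carrier
  H = hessian1 (basisPoly 𝔽 n N v K)

  isBasis : Vec (Fin N) n → Bool
  isBasis t = ⌊ LinAlg.isBasis? 𝔽 (v ∘ lookup t) ⌋

  hessian-sum : ∀ i j →
    H i j ≈ fromℕ (sumList (List.map (λ t → 𝟙 (isBasis t) ℕ.* ∂∂-coefficient i j (monomialExp t)) (increasing n N)))
  hessian-sum i j = trans (hessian1-sumOfMonomials (filter basis? (increasing n N)) i j)
    (reflexive (≡.cong fromℕ (sumList-filter basis? (∂∂-coefficient i j ∘ monomialExp) (increasing n N))))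
    where basis? = LinAlg.isBasis? 𝔽 ∘ (v ∘_) ∘ lookup

  hessian-diagonal : ∀ i → H i i ≈ 0#
  hessian-diagonal i = trans (hessian-sum i i) (reflexive (≡.cong fromℕ (≡.trans
    (sumList-map-All _ (λ _ → 0) (increasing n N) (All.map vanishes (increasing-Increasing n N)))
    (zeros (increasing n N)))))
    where
    vanishes : ∀ {t} → Increasing n N t → 𝟙 (isBasis t) ℕ.* ∂∂-coefficient i i (monomialExp t) ≡ 0
    vanishes {t} I = ≡.trans (≡.cong (𝟙 (isBasis t) ℕ.*_) (∂∂-coefficient-diagonal I i)) (ℕ.*-zeroʳ (𝟙 (isBasis t)))
    zeros : ∀ {A : Set} (xs : List.List A) → sumList (List.map (λ _ → 0) xs) ≡ 0
    zeros List.[]       = ≡.refl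
    zeros (x List.∷ xs) = zeros xs

  hessian-offDiagonal : ∀ i j → i ≢ j → 2 ≤ n → H i j ≈ fromℕ (supersetCount (n ∸ 2) (pair i j) isIndependent)
  hessian-offDiagonal i j i≢j 2≤n = trans (hessian-sum i j) (reflexive (≡.cong fromℕ (begin
    sumList (List.map (λ t → 𝟙 (isBasis t) ℕ.* ∂∂-coefficient i j (monomialExp t)) (increasing n N))
      ≡⟨ sumList-map-All _ (G ∘ toSubset) (increasing n N) (All.map term (increasing-Increasing n N)) ⟩
    sumList (List.map (G ∘ toSubset) (increasing n N))
      ≡⟨ sum-increasing n N G ⟩
    sumSubsets (λ s → 𝟙 (size s ≡ᵇ n) ℕ.* G s)
      ≡⟨ sumSubsets-cong containsPair ⟩
    supersetCount (n ∸ 2) (pair i j) isIndependent ∎)))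
    where
    open ≡.≡-Reasoning
    G : Subset N → ℕ
    G s = 𝟙 (isIndependent s) ℕ.* (𝟙 (lookup s j) ℕ.* 𝟙 (lookup s i))
    term : ∀ {t} → Increasing n N t → 𝟙 (isBasis t) ℕ.* ∂∂-coefficient i j (monomialExp t) ≡ G (toSubset t)
    term I = ≡.cong₂ ℕ._*_ (≡.cong 𝟙 (isBasis≡isIndependent I)) (∂∂-coefficient-offDiagonal I i j i≢j)
    absent : ∀ s k → k ≡ 0 → 𝟙 (size s ≡ᵇ n) ℕ.* (𝟙 (isIndependent s) ℕ.* k) ≡ 0
    absent s k k≡0 rewrite k≡0 =
      ≡.trans (≡.cong (𝟙 (size s ≡ᵇ n) ℕ.*_) (ℕ.*-zeroʳ (𝟙 (isIndependent s)))) (ℕ.*-zeroʳ (𝟙 (size s ≡ᵇ n)))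
    containsPair : ∀ s → 𝟙 (size s ≡ᵇ n) ℕ.* G s
                     ≡ 𝟙 ((pair i j ⊆ᵇ s) ∧ ((size s ≡ᵇ n ∸ 2 ℕ.+ size (pair i j)) ∧ isIndependent s))
    containsPair s rewrite pair⊆ᵇ i j s | size-pair i j i≢j | ℕ.m∸n+n≡m 2≤n with lookup s i | lookup s j
    ... | true  | true  = ≡.trans (≡.cong (𝟙 (size s ≡ᵇ n) ℕ.*_) (ℕ.*-identityʳ _)) (≡.sym (𝟙-∧ (size s ≡ᵇ n) _))
    ... | true  | false = absent s 0 ≡.refl
    ... | false | sⱼ    = absent s (𝟙 sⱼ ℕ.* 0) (ℕ.*-zeroʳ (𝟙 sⱼ))

module _ {a ℓ a′ ℓ′ r} (𝔽 : FiniteField a ℓ (suc (suc r))) (n N : ℕ) (v : Fin N → LinAlg.Vector 𝔽 n)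
         (lines : LinAlg.IsLineEnumeration 𝔽 n N v) (K : Field a′ ℓ′) (cz : CharZero K) where

  open Field K
  open FieldFacts K using (x*y≈z⇒y≈z*x⁻¹; fromℕ-*)
  open BasisPolynomialHessian 𝔽 n N v K
  open LinearAlgebra 𝔽 using (module Family)
  open Family v
  open QArithmetic r

  independentExtensions : ∀ A → Independent A → count (λ ℓ′ → not (inSpan A (v ℓ′))) ≡ linesOutside n (size A)
  independentExtensions A indep = linesOutside-unique n (size A) _ (LineCounting.count-linesOutsideSpan 𝔽 v lines A indep)

  bases⊇pair : ∀ i j → i ≢ j → 2 ≤ n →
    (n ∸ 2) ! ℕ.* supersetCount (n ∸ 2) (pair i j) isIndependent
      ≡ q ℕ.^ ((n ℕ.* n ∸ n ∸ 2) ℕ./ 2) ℕ.* prodFrom1 (n ∸ 2) (qNum q)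
  bases⊇pair i j i≢j 2≤n = ≡.trans
    (Supersets.factorial*supersetCount 𝔽 v (linesOutside n) independentExtensions (n ∸ 2) (pair i j)
                                       (LineCounting.Independent-pair 𝔽 v lines i j i≢j))
    (≡.trans (≡.cong (risingProduct (linesOutside n) (n ∸ 2)) (size-pair i j i≢j)) (risingProduct-linesOutside-from2 n 2≤n))

  hessian-offDiagonal-constC : ∀ i j → i ≢ j → 2 ≤ n → H i j ≈ constC K cz q n
  hessian-offDiagonal-constC i j i≢j 2≤n = trans (hessian-offDiagonal i j i≢j 2≤n)
    (x*y≈z⇒y≈z*x⁻¹ _ _ _ _ (trans (sym (fromℕ-* ((n ∸ 2) !) _)) (reflexive (≡.cong fromℕ (bases⊇pair i j i≢j 2≤n)))))

-- A field has the two distinct elements 0 and 1.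
FiniteField⇒2≤q : ∀ {a ℓ q} → FiniteField a ℓ q → 2 ≤ q
FiniteField⇒2≤q {q = zero}        𝔽 with () ← FiniteField.index 𝔽 (FiniteField.0# 𝔽)
FiniteField⇒2≤q {q = suc zero}    𝔽 =
  ⊥-elim (1≉0 (trans (sym (enum-index 1#)) (trans (reflexive (≡.cong enum sameIndex)) (enum-index 0#))))
  where
  open FiniteField 𝔽
  sameIndex : index 1# ≡ index 0#
  sameIndex with index 1# | index 0#
  ... | zero | zero = ≡.refl
FiniteField⇒2≤q {q = suc (suc r)} 𝔽 = s≤s (s≤s z≤n)

lineEnumeration-nonempty : ∀ {a ℓ q} (𝔽 : FiniteField a ℓ q) {n N} (v : Fin N → LinAlg.Vector 𝔽 n) →
  LinAlg.IsLineEnumeration 𝔽 n N v → 1 ≤ n → 1 ≤ N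
lineEnumeration-nonempty 𝔽 {suc n} v lines _ = positive (proj₁ (covers (λ _ → 1#) (λ 1≈0 → 1≉0 (1≈0 zero))))
  where
  open FiniteField 𝔽
  open LinAlg.IsLineEnumeration lines
  positive : ∀ {N} → Fin N → 1 ≤ N
  positive {suc N} _ = s≤s z≤n

hessian-entries : ∀ {a ℓ a′ ℓ′} q (𝔽 : FiniteField a ℓ q) n → 2 ≤ n → ∀ N (v : Fin N → LinAlg.Vector 𝔽 n) →
  LinAlg.IsLineEnumeration 𝔽 n N v → (K : Field a′ ℓ′) (cz : CharZero K) →
  Determinant.ZeroDiagonalConstant K (PolyOps.hessian1 K (basisPoly 𝔽 n N v K)) (constC K cz q n)
hessian-entries zero          𝔽 n 2≤n N v lines K cz with () ← FiniteField⇒2≤q 𝔽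
hessian-entries (suc zero)    𝔽 n 2≤n N v lines K cz with s≤s () ← FiniteField⇒2≤q 𝔽
hessian-entries (suc (suc r)) 𝔽 n 2≤n N v lines K cz i j =
  (λ { ≡.refl → hessian-diagonal i }) , λ i≢j → hessian-offDiagonal-constC 𝔽 n N v lines K cz i j i≢j 2≤n
  where open BasisPolynomialHessian 𝔽 n N v K

corollary4p12 : ∀ {a ℓ a′ ℓ′} (q : ℕ) (𝔽 : FiniteField a ℓ q) (n : ℕ) → 2 ≤ n →
  (v : Fin (numLines q n) → LinAlg.Vector 𝔽 n) →
  LinAlg.IsLineEnumeration 𝔽 n (numLines q n) v →
  (K : Field a′ ℓ′) (charK : CharZero K) →
  let open Field K
      open PolyOps K
      N = numLines q n
      H = hessian1 (basisPoly 𝔽 n N v K)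
      c = constC K charK q n
  in ((∀ i j → (i ≡ j → H i j ≈ 0#) × (¬ (i ≡ j) → H i j ≈ c)))
     × ((det N H ≈ (fromℕ (N ∸ 1) * pow c N))
        ⊎ (det N H ≈ (- (fromℕ (N ∸ 1) * pow c N))))
corollary4p12 q 𝔽 n 2≤n v lines K charK =
  entries , Determinant.det-zeroDiagonalConstant-± K (charK 1) N H c N≥1 entries
  where
  N = numLines q n
  H = PolyOps.hessian1 K (basisPoly 𝔽 n N v K)
  c = constC K charK q n
  entries = hessian-entries q 𝔽 n 2≤n N v lines K charK
  N≥1 = lineEnumeration-nonempty 𝔽 v lines (ℕ.≤-trans (s≤s z≤n) 2≤n)
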